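{- For all $n\geq 0$, $$B_n=\sum_{\lambda\vdash n}\prod_{j\ge1}h_{m_j(\lambda)}(h_j),$$ where $m_j(\lambda)$ is the number of parts of $\lambda$ equal to $j$ and $h_k(h_j)$ denotes plethysm.
   Context: Let $\Lambda$ be the ring of symmetric functions over $\mathbb{Q}$ in variables $X=(x_1,x_2,\ldots)$, completed with respect to degree. Write $h_n$ for complete homogeneous and $p_k$ for power sum symmetric functions. Plethysm: for a formal power series $A$ in the $x_i$ and auxiliary commuting variables (e.g. $t$), $p_k(A)$ is obtained from $A$ by replacing every variable by its $k$-th power, and for $F\in\Lambda$, $F(A)$ is obtained by writing $F$ in terms of the $p_k$ and substituting $p_k\mapsto p_k(A)$ (used only when $A$ has zero constant term, or $F$ is a polynomial). The alphabet $tX$ means $(tx_1,tx_2,\ldots)$. Let $\Omega(X)=\sum_{n\ge0}h_n(X)$ and $\Omega_0(X)=\Omega(X)-1$. The Bell symmetric functions $B_n$ are defined by $\Omega(\Omega_0(tX))=\sum_{n\ge0}B_n(X)t^n$. -}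

module Defs where

open import Data.Nat as ℕ using (ℕ; zero; suc; _^_)
open import Data.Nat.ListAction using (product; sum)
open import Data.Integer using (+_)
open import Data.Rational as ℚ using (ℚ; 0ℚ; 1ℚ)
open import Data.List as List using (List; []; _∷_; _++_; map; foldr; concatMap; upTo; replicate; filter; length)
open import Data.List.Properties using (≡-dec)
open import Data.Product using (_×_; _,_)
open import Relation.Nullary using (Dec; yes; no)
open import Relation.Binary.PropositionalEquality using (_≡_)

-- Model of the coefficient ring.
-- Λ_ℚ is the free polynomial algebra ℚ[p₁,p₂,…] on the power sums.
-- We work in ℚ[t, p₁, p₂, …] (t the auxiliary variable).
-- A monomial is an exponent list: position 0 = exponent of t,
-- position i ≥ 1 = exponent of p_i (missing entries are 0).
-- A polynomial is a finite list of (coefficient , monomial) terms;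
-- two polynomials are equal when all their coefficients agree.

Mono : Set
Mono = List ℕ

Poly : Set
Poly = List (ℚ × Mono)

trim : Mono → Mono
trim [] = []
trim (e ∷ es) with trim es
... | [] with e
...   | zero  = []
...   | suc k = suc k ∷ []
trim (e ∷ es) | r ∷ rs = e ∷ r ∷ rs

sumℚ : List ℚ → ℚ
sumℚ = foldr ℚ._+_ 0ℚ

coeff : Poly → Mono → ℚ
coeff [] m = 0ℚ
coeff ((c , m′) ∷ P) m with ≡-dec ℕ._≟_ (trim m′) (trim m)
... | yes _ = c ℚ.+ coeff P m
... | no  _ = coeff P m

_≈P_ : Poly → Poly → Set
P ≈P Q = (m : Mono) → coeff P m ≡ coeff Q m

mulMono : Mono → Mono → Mono
mulMono [] ys = ys
mulMono (x ∷ xs) [] = x ∷ xs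
mulMono (x ∷ xs) (y ∷ ys) = (x ℕ.+ y) ∷ mulMono xs ys

0P : Poly
0P = []

1P : Poly
1P = (1ℚ , []) ∷ []

_+P_ : Poly → Poly → Poly
_+P_ = _++_

_*P_ : Poly → Poly → Poly
P *P Q = concatMap (λ { (c , m) → map (λ { (d , n) → (c ℚ.* d , mulMono m n) }) Q }) P

scaleP : ℚ → Poly → Poly
scaleP c = map (λ { (d , m) → (c ℚ.* d , m) })

_^P_ : Poly → ℕ → Poly
P ^P zero = 1P
P ^P suc e = P *P (P ^P e)

sumP : List Poly → Poly
sumP = foldr _+P_ 0P

prodP : List Poly → Poly
prodP = foldr _*P_ 1P

-- the monomial (variable number v)^e ; v = 0 is t, v = i ≥ 1 is p_i
varPow : ℕ → ℕ → Mono
varPow v e = replicate v 0 ++ (e ∷ [])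

tP : Poly
tP = (1ℚ , varPow 0 1) ∷ []

pP : ℕ → Poly
pP i = (1ℚ , varPow i 1) ∷ []

-- Plethysm.
-- p_k(A): replace every variable by its k-th power.  On ℚ[t,p₁,p₂,…]
-- (coefficients are rational constants) this is the ring map
-- t ↦ t^k , p_i ↦ p_{ik}, i.e. a map on monomials.

pkMonoFrom : ℕ → ℕ → Mono → Mono
pkMonoFrom k i [] = []
pkMonoFrom k i (e ∷ es) = mulMono (varPow (i ℕ.* k) e) (pkMonoFrom k (suc i) es)

pkMono : ℕ → Mono → Mono
pkMono k [] = []
pkMono k (e ∷ es) = mulMono (varPow 0 (k ℕ.* e)) (pkMonoFrom k 1 es)

pk : ℕ → Poly → Poly
pk k = map (λ { (c , m) → (c , pkMono k m) })

-- F(A) for F ∈ Λ = ℚ[p₁,p₂,…] written in the p's: substitute p_i ↦ p_i(A).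
-- (F has no t; a t-exponent in F, which never occurs, is kept as t.)
plethMonoFrom : ℕ → Mono → Poly → Poly
plethMonoFrom i [] A = 1P
plethMonoFrom i (e ∷ es) A = (pk i A ^P e) *P plethMonoFrom (suc i) es A

plethMono : Mono → Poly → Poly
plethMono [] A = 1P
plethMono (e ∷ es) A = (tP ^P e) *P plethMonoFrom 1 es A

pleth : Poly → Poly → Poly
pleth F A = sumP (map (λ { (c , m) → scaleP c (plethMono m A) }) F)

-- Integer partitions: lists of positive parts in weakly decreasing order.
-- partsFuel f n k = all partitions of n with all parts ≤ k
-- (fuel f ≥ n + k suffices, each call lowers n + k).

partsFuel : ℕ → ℕ → ℕ → List (List ℕ)
partsFuel _ zero _ = [] ∷ []
partsFuel zero (suc _) _ = []
partsFuel (suc f) (suc n) zero = []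
partsFuel (suc f) (suc n) (suc k) with suc k ℕ.≤? suc n
... | yes _ = partsFuel f (suc n) k ++ map (suc k ∷_) (partsFuel f (suc n ℕ.∸ suc k) (suc k))
... | no  _ = partsFuel f (suc n) k

partitions : ℕ → List (List ℕ)
partitions n = partsFuel (n ℕ.+ n) n n

mult : ℕ → List ℕ → ℕ
mult j λ′ = length (filter (ℕ._≟ j) λ′)

pMono : List ℕ → Mono
pMono λ′ = foldr (λ j acc → mulMono (varPow j 1) acc) [] λ′

zλ : List ℕ → ℕ
zλ λ′ = product (map (λ j → (j ^ mult j λ′) ℕ.* (mult j λ′) ℕ.!) (upTo (suc (sum λ′))))

recip : ℕ → ℚ
recip zero = 0ℚ
recip (suc k) = (+ 1) ℚ./ suc k

-- complete homogeneous symmetric function h_n = Σ_{λ ⊢ n} p_λ / z_λ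
h : ℕ → Poly
h n = map (λ λ′ → (recip (zλ λ′) , pMono λ′)) (partitions n)

-- Bell symmetric functions.
-- Ω(Ω₀(tX)) = Σ_{m≥0} h_m( Σ_{j≥1} h_j(tX) ).  Since every h_j(tX) is
-- divisible by t^j and h_m(A) by t^m when A ∈ tℚ[t,p][[t]], the t^n
-- coefficient only involves m ≤ n and j ≤ n, so we truncate there.

tX : Poly
tX = (1ℚ , mulMono (varPow 0 1) (varPow 1 1)) ∷ []   -- the alphabet tX, i.e. t·p₁

Ω₀tX-trunc : ℕ → Poly
Ω₀tX-trunc N = sumP (map (λ j → pleth (h (suc j)) tX) (upTo N))

ΩΩ₀tX-trunc : ℕ → Poly
ΩΩ₀tX-trunc N = sumP (map (λ m → pleth (h m) (Ω₀tX-trunc N)) (upTo (suc N)))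

tExp : Mono → ℕ
tExp [] = 0
tExp (e ∷ _) = e

dropT : Mono → Mono
dropT [] = []
dropT (_ ∷ es) = 0 ∷ es

tCoeff : ℕ → Poly → Poly
tCoeff n [] = []
tCoeff n ((c , m) ∷ P) with tExp m ℕ.≟ n
... | yes _ = (c , dropT m) ∷ tCoeff n P
... | no  _ = tCoeff n P

B : ℕ → Poly
B n = tCoeff n (ΩΩ₀tX-trunc n)

-- right-hand side: Σ_{λ ⊢ n} ∏_{j ≥ 1} h_{m_j(λ)}(h_j)
-- (factors with j > n have m_j(λ) = 0 and equal h₀(h_j) = 1)
bellRHS : ℕ → Poly
bellRHS n = sumP (map (λ λ′ → prodP (map (λ j → pleth (h (mult (suc j) λ′)) (h (suc j))) (upTo n))) (partitions n))

module Submission where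

-- Ω is exponential, Ω[A + B] = Ω[A] Ω[B]: writing h_m[C] = Σ_{λ ⊢ m} Π_j p_j[C]^{m_j} / (j^{m_j} m_j!)
-- turns Ω[C] into Π_j exp (p_j[C] / j), and p_j[A + B] = p_j[A] + p_j[B].  As Ω₀[tX] = Σ_{j ≥ 1} h_j[tX],
-- Ω[Ω₀[tX]] = Π_j Ω[h_j[tX]] = Π_j Σ_a h_a[h_j[tX]], and expanding the product groups the terms by the
-- partition λ with m_j(λ) = a_j.  The factor h_a[h_j[tX]] is homogeneous of degree a j in t, so the
-- coefficient of tⁿ collects exactly the partitions of n, and t ↦ 1 turns h_a[h_j[tX]] into h_a[h_j].
-- All of this is needed only modulo t^{n+1}, which is all that the truncated definition of B n sees.

open import Defs
open import Level using (0ℓ)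
open import Algebra.Bundles using (CommutativeRing)
open import Algebra.Structures using (IsCommutativeRing)
import Algebra.Properties.CommutativeSemiring.Binomial as BinomialTheorem
open import Data.Empty using (⊥-elim)
open import Data.Fin using (toℕ)
import Data.Integer as ℤ
import Data.Integer.Properties as ZP
open import Data.List using (List; []; _∷_; _++_; map; concatMap; replicate; length; applyUpTo)
import Data.List.Properties as LP
open import Data.List.Properties using (≡-dec)
open import Data.List.Relation.Unary.All as All using (All; []; _∷_)
import Data.List.Relation.Unary.All.Properties as All
open import Data.Nat as ℕ using (ℕ; zero; suc; _≤_; _<_; z≤n; s≤s; _∸_; _^_; _!) renaming (_+_ to _+ℕ_; _*_ to _*ℕ_)
import Data.Nat.Properties as NP
open import Data.Nat.Properties using (_!≢0; _!*_!≢0)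
open import Data.Nat.Combinatorics using () renaming (_C_ to _choose_)
import Data.Nat.Combinatorics as NC
import Data.Nat.Combinatorics.Specification as NCS
import Data.Nat.DivMod as DM
open import Data.Nat.ListAction using (product; sum)
open import Data.Nat.Tactic.RingSolver using () renaming (solve-∀ to solveℕ-∀)
open import Data.Product using (_×_; _,_; proj₁; proj₂)
open import Data.Rational using (ℚ; 0ℚ; 1ℚ; _+_; _*_; -_; toℚᵘ; fromℚᵘ)
import Data.Rational.Properties as QP
open import Data.Rational.Solver using (module +-*-Solver)
open +-*-Solver using (solve; _:=_; con; _:+_; _:*_)
open import Data.Rational.Unnormalised using (mkℚᵘ; *≡*) renaming (_≃_ to _≃ᵘ_)
import Data.Rational.Unnormalised.Properties as UP
open import Data.Sum using (_⊎_; inj₁; inj₂)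
open import Data.Unit using (⊤; tt)
open import Function using (_∘_)
import Relation.Binary.Reasoning.Setoid as SetoidReasoning
open import Relation.Binary.PropositionalEquality using (_≡_; refl; sym; trans; cong; cong₂; subst; module ≡-Reasoning)
open import Relation.Nullary using (Dec; yes; no; ¬_)

-- Monomials

exponent : Mono → ℕ → ℕ
exponent [] _ = 0
exponent (e ∷ es) zero = e
exponent (e ∷ es) (suc i) = exponent es i

infix 4 _≋_
record _≋_ (a b : Mono) : Set where
  constructor mk≋
  field at : ∀ i → exponent a i ≡ exponent b i
open _≋_ public

≋-refl : ∀ {a} → a ≋ a
≋-refl = mk≋ λ i → refl

≋-sym : ∀ {a b} → a ≋ b → b ≋ a
≋-sym p = mk≋ λ i → sym (at p i)

≋-trans : ∀ {a b c} → a ≋ b → b ≋ c → a ≋ c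
≋-trans p q = mk≋ λ i → trans (at p i) (at q i)

≡⇒≋ : ∀ {a b} → a ≡ b → a ≋ b
≡⇒≋ refl = ≋-refl

≋-head : ∀ {e e' es es'} → (e ∷ es) ≋ (e' ∷ es') → e ≡ e'
≋-head p = at p 0

≋-tail : ∀ {e e' es es'} → (e ∷ es) ≋ (e' ∷ es') → es ≋ es'
≋-tail p = mk≋ λ i → at p (suc i)

≋-cons : ∀ {e e' es es'} → e ≡ e' → es ≋ es' → (e ∷ es) ≋ (e' ∷ es')
≋-cons p q = mk≋ λ { zero → p ; (suc i) → at q i }

[]≋-head : ∀ {e es} → [] ≋ (e ∷ es) → 0 ≡ e
[]≋-head p = at p 0

[]≋-tail : ∀ {e es} → [] ≋ (e ∷ es) → [] ≋ es
[]≋-tail p = mk≋ λ i → at p (suc i)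

trimCons : ℕ → Mono → Mono
trimCons e (r ∷ rs) = e ∷ r ∷ rs
trimCons zero [] = []
trimCons (suc k) [] = suc k ∷ []

trim-∷ : ∀ e es → trim (e ∷ es) ≡ trimCons e (trim es)
trim-∷ e es with trim es
... | [] with e
...   | zero = refl
...   | suc k = refl
trim-∷ e es | r ∷ rs = refl

exponent-trimCons : ∀ e r i → exponent (trimCons e r) i ≡ exponent (e ∷ r) i
exponent-trimCons e (x ∷ r) i = refl
exponent-trimCons zero [] zero = refl
exponent-trimCons zero [] (suc i) = refl
exponent-trimCons (suc e) [] i = refl

exponent-trim : ∀ a i → exponent a i ≡ exponent (trim a) i
exponent-trim [] i = refl
exponent-trim (e ∷ es) i rewrite trim-∷ e es = sym (trans (exponent-trimCons e (trim es) i) (pointwise i))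
  where
  pointwise : ∀ i → exponent (e ∷ trim es) i ≡ exponent (e ∷ es) i
  pointwise zero = refl
  pointwise (suc i) = sym (exponent-trim es i)

≋-trim : ∀ a → a ≋ trim a
≋-trim a = mk≋ (exponent-trim a)

[]≋⇒[]≡trim : ∀ es → [] ≋ es → [] ≡ trim es
[]≋⇒[]≡trim [] p = refl
[]≋⇒[]≡trim (e ∷ es) p = sym (trans (trim-∷ e es) (cong₂ trimCons (sym ([]≋-head p)) (sym ([]≋⇒[]≡trim es ([]≋-tail p)))))

≋⇒trim≡ : ∀ a b → a ≋ b → trim a ≡ trim b
≋⇒trim≡ [] b p = []≋⇒[]≡trim b p
≋⇒trim≡ (e ∷ es) [] p = sym ([]≋⇒[]≡trim (e ∷ es) (≋-sym p))
≋⇒trim≡ (e ∷ es) (e' ∷ es') p = trans (trim-∷ e es) (trans (cong₂ trimCons (≋-head p) (≋⇒trim≡ es es' (≋-tail p))) (sym (trim-∷ e' es')))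

trim≡⇒≋ : ∀ a b → trim a ≡ trim b → a ≋ b
trim≡⇒≋ a b p = ≋-trans (≋-trim a) (≋-trans (mk≋ λ i → cong (λ z → exponent z i) p) (≋-sym (≋-trim b)))

exponent-mulMono : ∀ a b i → exponent (mulMono a b) i ≡ exponent a i +ℕ exponent b i
exponent-mulMono [] b i = refl
exponent-mulMono (x ∷ a) [] i = sym (NP.+-identityʳ _)
exponent-mulMono (x ∷ a) (y ∷ b) zero = refl
exponent-mulMono (x ∷ a) (y ∷ b) (suc i) = exponent-mulMono a b i

mulMono-cong : ∀ {a a' b b'} → a ≋ a' → b ≋ b' → mulMono a b ≋ mulMono a' b'
mulMono-cong {a} {a'} {b} {b'} p q = mk≋ λ i → trans (exponent-mulMono a b i) (trans (cong₂ _+ℕ_ (at p i) (at q i)) (sym (exponent-mulMono a' b' i)))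

mulMono-comm : ∀ a b → mulMono a b ≋ mulMono b a
mulMono-comm a b = mk≋ λ i → trans (exponent-mulMono a b i) (trans (NP.+-comm (exponent a i) (exponent b i)) (sym (exponent-mulMono b a i)))

mulMono-assoc : ∀ a b c → mulMono (mulMono a b) c ≋ mulMono a (mulMono b c)
mulMono-assoc a b c = mk≋ λ i → trans (exponent-mulMono (mulMono a b) c i) (trans (cong (_+ℕ exponent c i) (exponent-mulMono a b i))
   (trans (NP.+-assoc (exponent a i) (exponent b i) (exponent c i)) (sym (trans (exponent-mulMono a (mulMono b c) i) (cong (exponent a i +ℕ_) (exponent-mulMono b c i))))))

mulMono-identityˡ : ∀ a → mulMono [] a ≋ a
mulMono-identityˡ a = ≋-refl

mulMono-identityʳ : ∀ a → mulMono a [] ≋ a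
mulMono-identityʳ a = mk≋ λ i → trans (exponent-mulMono a [] i) (NP.+-identityʳ _)

exponent-varPow-same : ∀ v e → exponent (varPow v e) v ≡ e
exponent-varPow-same zero e = refl
exponent-varPow-same (suc v) e = exponent-varPow-same v e

exponent-varPow-other : ∀ v e i → ¬ (i ≡ v) → exponent (varPow v e) i ≡ 0
exponent-varPow-other zero e zero ne = ⊥-elim (ne refl)
exponent-varPow-other zero e (suc i) ne = refl
exponent-varPow-other (suc v) e zero ne = refl
exponent-varPow-other (suc v) e (suc i) ne = exponent-varPow-other v e i (λ eq → ne (cong suc eq))

varPow-zero : ∀ v → varPow v 0 ≋ []
varPow-zero v = mk≋ pointwise
  where
  pointwise : ∀ i → exponent (varPow v 0) i ≡ 0
  pointwise i with i ℕ.≟ v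
  ... | yes refl = exponent-varPow-same v 0
  ... | no ne = exponent-varPow-other v 0 i ne

varPow-+ : ∀ v e f → varPow v (e +ℕ f) ≋ mulMono (varPow v e) (varPow v f)
varPow-+ v e f = mk≋ pointwise
  where
  pointwise : ∀ i → exponent (varPow v (e +ℕ f)) i ≡ exponent (mulMono (varPow v e) (varPow v f)) i
  pointwise i rewrite exponent-mulMono (varPow v e) (varPow v f) i with i ℕ.≟ v
  ... | yes refl rewrite exponent-varPow-same v (e +ℕ f) | exponent-varPow-same v e | exponent-varPow-same v f = refl
  ... | no ne rewrite exponent-varPow-other v (e +ℕ f) i ne | exponent-varPow-other v e i ne | exponent-varPow-other v f i ne = refl

varPow-cong : ∀ v {e f} → e ≡ f → varPow v e ≋ varPow v f
varPow-cong v refl = ≋-refl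

tExp≡exponent0 : ∀ a → tExp a ≡ exponent a 0
tExp≡exponent0 [] = refl
tExp≡exponent0 (x ∷ a) = refl

tExp-cong : ∀ {a b} → a ≋ b → tExp a ≡ tExp b
tExp-cong {a} {b} p = trans (tExp≡exponent0 a) (trans (at p 0) (sym (tExp≡exponent0 b)))

tExp-mulMono : ∀ a b → tExp (mulMono a b) ≡ tExp a +ℕ tExp b
tExp-mulMono a b = trans (tExp≡exponent0 (mulMono a b)) (trans (exponent-mulMono a b 0) (sym (cong₂ _+ℕ_ (tExp≡exponent0 a) (tExp≡exponent0 b))))

exponent-dropT-suc : ∀ a i → exponent (dropT a) (suc i) ≡ exponent a (suc i)
exponent-dropT-suc [] i = refl
exponent-dropT-suc (x ∷ a) i = refl

exponent-dropT-zero : ∀ a → exponent (dropT a) 0 ≡ 0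
exponent-dropT-zero [] = refl
exponent-dropT-zero (x ∷ a) = refl

dropT-cong : ∀ {a b} → a ≋ b → dropT a ≋ dropT b
dropT-cong {a} {b} p = mk≋ λ { zero → trans (exponent-dropT-zero a) (sym (exponent-dropT-zero b)) ; (suc i) → trans (exponent-dropT-suc a i) (trans (at p (suc i)) (sym (exponent-dropT-suc b i))) }

dropT-tExp0 : ∀ a → tExp a ≡ 0 → dropT a ≋ a
dropT-tExp0 a e = mk≋ λ { zero → trans (exponent-dropT-zero a) (sym (trans (sym (tExp≡exponent0 a)) e)) ; (suc i) → exponent-dropT-suc a i }

pkMonoFrom-[]≋ : ∀ k j es → [] ≋ es → [] ≋ pkMonoFrom k j es
pkMonoFrom-[]≋ k j [] p = ≋-refl
pkMonoFrom-[]≋ k j (e ∷ es) p =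
  ≋-sym (≋-trans (mulMono-cong (≋-trans (varPow-cong (j *ℕ k) (sym ([]≋-head p))) (varPow-zero (j *ℕ k))) (≋-sym (pkMonoFrom-[]≋ k (suc j) es ([]≋-tail p)))) ≋-refl)

pkMonoFrom-cong : ∀ k j a b → a ≋ b → pkMonoFrom k j a ≋ pkMonoFrom k j b
pkMonoFrom-cong k j [] b p = pkMonoFrom-[]≋ k j b p
pkMonoFrom-cong k j (e ∷ es) [] p = ≋-sym (pkMonoFrom-[]≋ k j (e ∷ es) (≋-sym p))
pkMonoFrom-cong k j (e ∷ es) (e' ∷ es') p = mulMono-cong (varPow-cong (j *ℕ k) (≋-head p)) (pkMonoFrom-cong k (suc j) es es' (≋-tail p))

pkMono-[]≋ : ∀ k es → [] ≋ es → [] ≋ pkMono k es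
pkMono-[]≋ k [] p = ≋-refl
pkMono-[]≋ k (e ∷ es) p =
  ≋-sym (≋-trans (mulMono-cong (≋-trans (varPow-cong 0 (trans (cong (k *ℕ_) (sym ([]≋-head p))) (NP.*-zeroʳ k))) (varPow-zero 0)) (≋-sym (pkMonoFrom-[]≋ k 1 es ([]≋-tail p)))) ≋-refl)

pkMono-cong : ∀ k a b → a ≋ b → pkMono k a ≋ pkMono k b
pkMono-cong k [] b p = pkMono-[]≋ k b p
pkMono-cong k (e ∷ es) [] p = ≋-sym (pkMono-[]≋ k (e ∷ es) (≋-sym p))
pkMono-cong k (e ∷ es) (e' ∷ es') p = mulMono-cong (varPow-cong 0 (cong (k *ℕ_) (≋-head p))) (pkMonoFrom-cong k 1 es es' (≋-tail p))

exponent0-pkMonoFrom : ∀ k j a → exponent (pkMonoFrom (suc k) (suc j) a) 0 ≡ 0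
exponent0-pkMonoFrom k j [] = refl
exponent0-pkMonoFrom k j (x ∷ a) rewrite exponent-mulMono (varPow (suc j *ℕ suc k) x) (pkMonoFrom (suc k) (suc (suc j)) a) 0 | exponent0-pkMonoFrom k (suc j) a = refl

tExp-pkMono : ∀ k a → tExp (pkMono (suc k) a) ≡ suc k *ℕ tExp a
tExp-pkMono k [] = sym (NP.*-zeroʳ (suc k))
tExp-pkMono k (x ∷ a) rewrite tExp-mulMono (varPow 0 (suc k *ℕ x)) (pkMonoFrom (suc k) 1 a) | tExp≡exponent0 (pkMonoFrom (suc k) 1 a) | exponent0-pkMonoFrom k 0 a = NP.+-identityʳ _

-- Coefficients through linear functionals

-- L g is the linear extension of g : Mono → ℚ; coefficients are L (δ m), and every ring law is
-- proved by comparing L g on both sides for all g that respect _≋_.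
L : (Mono → ℚ) → Poly → ℚ
L g [] = 0ℚ
L g ((c , a) ∷ P) = c * g a + L g P

≋-Congruent : (Mono → ℚ) → Set
≋-Congruent g = ∀ {a b} → a ≋ b → g a ≡ g b

δ≡ : Mono → Mono → ℚ
δ≡ x y with ≡-dec ℕ._≟_ x y
... | yes _ = 1ℚ
... | no _ = 0ℚ

δ≡-yes : ∀ {x y} → x ≡ y → δ≡ x y ≡ 1ℚ
δ≡-yes {x} {y} p with ≡-dec ℕ._≟_ x y
... | yes _ = refl
... | no ¬p = ⊥-elim (¬p p)

δ≡-no : ∀ {x y} → ¬ x ≡ y → δ≡ x y ≡ 0ℚ
δ≡-no {x} {y} p with ≡-dec ℕ._≟_ x y
... | yes q = ⊥-elim (p q)
... | no ¬p = refl

δ : Mono → Mono → ℚ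
δ m a = δ≡ (trim a) (trim m)

δ-cong : ∀ m → ≋-Congruent (δ m)
δ-cong m {a} {b} p = cong (λ z → δ≡ z (trim m)) (≋⇒trim≡ a b p)

δ-yes : ∀ {m a} → a ≋ m → δ m a ≡ 1ℚ
δ-yes {m} {a} p = δ≡-yes (≋⇒trim≡ a m p)

δ-no : ∀ {m a} → ¬ a ≋ m → δ m a ≡ 0ℚ
δ-no {m} {a} p = δ≡-no (λ q → p (trim≡⇒≋ a m q))

infix 4 _≋?_
_≋?_ : ∀ a b → Dec (a ≋ b)
a ≋? b with ≡-dec ℕ._≟_ (trim a) (trim b)
... | yes p = yes (trim≡⇒≋ a b p)
... | no ¬p = no (λ q → ¬p (≋⇒trim≡ a b q))

coeff≡L : ∀ P m → coeff P m ≡ L (δ m) P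
coeff≡L [] m = refl
coeff≡L ((c , m') ∷ P) m with ≡-dec ℕ._≟_ (trim m') (trim m)
... | yes p = cong₂ _+_ (sym (QP.*-identityʳ c)) (coeff≡L P m)
... | no ¬p = trans (coeff≡L P m) (sym (trans (cong (_+ L (δ m) P) (QP.*-zeroʳ c)) (QP.+-identityˡ _)))

L-++ : ∀ g P Q → L g (P ++ Q) ≡ L g P + L g Q
L-++ g [] Q = sym (QP.+-identityˡ _)
L-++ g ((c , a) ∷ P) Q = trans (cong (c * g a +_) (L-++ g P Q)) (sym (QP.+-assoc (c * g a) (L g P) (L g Q)))

L-ext : ∀ {g h} P → (∀ a → g a ≡ h a) → L g P ≡ L h P
L-ext [] e = refl
L-ext ((c , a) ∷ P) e = cong₂ (λ x y → c * x + y) (e a) (L-ext P e)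

L-+ : ∀ g h P → L (λ a → g a + h a) P ≡ L g P + L h P
L-+ g h [] = sym (QP.+-identityˡ _)
L-+ g h ((c , a) ∷ P) rewrite L-+ g h P = rearrange c (g a) (h a) (L g P) (L h P)
  where
  rearrange : ∀ c x y u v → c * (x + y) + (u + v) ≡ (c * x + u) + (c * y + v)
  rearrange = solve 5 (λ c x y u v → (c :* (x :+ y) :+ (u :+ v)) := ((c :* x :+ u) :+ (c :* y :+ v))) refl

L-scaleFun : ∀ d g P → L (λ a → d * g a) P ≡ d * L g P
L-scaleFun d g [] = sym (QP.*-zeroʳ d)
L-scaleFun d g ((c , a) ∷ P) rewrite L-scaleFun d g P = rearrange c d (g a) (L g P)
  where
  rearrange : ∀ c d x u → c * (d * x) + d * u ≡ d * (c * x + u)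
  rearrange = solve 4 (λ c d x u → (c :* (d :* x) :+ d :* u) := (d :* (c :* x :+ u))) refl

L-0 : ∀ P → L (λ _ → 0ℚ) P ≡ 0ℚ
L-0 [] = refl
L-0 ((c , a) ∷ P) rewrite L-0 P | QP.*-zeroʳ c = refl

L-scaleP : ∀ g d P → L g (scaleP d P) ≡ d * L g P
L-scaleP g d [] = sym (QP.*-zeroʳ d)
L-scaleP g d ((c , a) ∷ P) rewrite L-scaleP g d P = rearrange c d (g a) (L g P)
  where
  rearrange : ∀ c d x u → d * c * x + d * u ≡ d * (c * x + u)
  rearrange = solve 4 (λ c d x u → (d :* c :* x :+ d :* u) := (d :* (c :* x :+ u))) refl

L-singleton-*P : ∀ g c a Q → L g (((c , a) ∷ []) *P Q) ≡ c * L (λ b → g (mulMono a b)) Q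
L-singleton-*P g c a [] = sym (QP.*-zeroʳ c)
L-singleton-*P g c a ((d , n) ∷ Q) = trans (cong (c * d * g (mulMono a n) +_) (L-singleton-*P g c a Q)) (rearrange c d (g (mulMono a n)) (L (λ b → g (mulMono a b)) Q))
  where
  rearrange : ∀ c d x u → c * d * x + c * u ≡ c * (d * x + u)
  rearrange = solve 4 (λ c d x u → (c :* d :* x :+ c :* u) := (c :* (d :* x :+ u))) refl

L-concatMap : ∀ g (f : ℚ × Mono → Poly) (H : Mono → ℚ) → (∀ c a → L g (f (c , a) ++ []) ≡ c * H a) → ∀ P → L g (concatMap f P) ≡ L H P
L-concatMap g f H hyp [] = refl
L-concatMap g f H hyp ((c , a) ∷ P) =
  trans (L-++ g (f (c , a)) (concatMap f P))
   (cong₂ _+_ (trans (sym (trans (L-++ g (f (c , a)) []) (QP.+-identityʳ (L g (f (c , a)))))) (hyp c a)) (L-concatMap g f H hyp P))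

L-* : ∀ g P Q → L g (P *P Q) ≡ L (λ a → L (λ b → g (mulMono a b)) Q) P
L-* g P Q = L-concatMap g _ _ (λ c a → L-singleton-*P g c a Q) P

L-swap : ∀ (G : Mono → Mono → ℚ) P Q → L (λ a → L (λ b → G a b) Q) P ≡ L (λ b → L (λ a → G a b) P) Q
L-swap G [] Q = sym (L-0 Q)
L-swap G ((c , a) ∷ P) Q = trans (cong₂ _+_ (sym (L-scaleFun c (G a) Q)) (L-swap G P Q)) (sym (L-+ _ _ Q))

L-pk : ∀ g k P → L g (pk k P) ≡ L (λ a → g (pkMono k a)) P
L-pk g k [] = refl
L-pk g k ((c , a) ∷ P) = cong (c * g (pkMono k a) +_) (L-pk g k P)

select : Mono → Poly → Poly
select a [] = []
select a ((d , b) ∷ Z) with b ≋? a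
... | yes _ = (d , b) ∷ select a Z
... | no _ = select a Z

reject : Mono → Poly → Poly
reject a [] = []
reject a ((d , b) ∷ Z) with b ≋? a
... | yes _ = reject a Z
... | no _ = (d , b) ∷ reject a Z

L-select-reject : ∀ g a Z → L g Z ≡ L g (select a Z) + L g (reject a Z)
L-select-reject g a [] = sym (QP.+-identityˡ _)
L-select-reject g a ((d , b) ∷ Z) with b ≋? a
... | yes _ = trans (cong (d * g b +_) (L-select-reject g a Z)) (sym (QP.+-assoc (d * g b) (L g (select a Z)) (L g (reject a Z))))
... | no _ rewrite L-select-reject g a Z = rearrange (d * g b) (L g (select a Z)) (L g (reject a Z))
  where
  rearrange : ∀ x y z → x + (y + z) ≡ y + (x + z)
  rearrange = solve 3 (λ x y z → (x :+ (y :+ z)) := (y :+ (x :+ z))) refl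

L-select : ∀ g → ≋-Congruent g → ∀ a Z → L g (select a Z) ≡ g a * L (δ a) Z
L-select g gr a [] = sym (QP.*-zeroʳ (g a))
L-select g gr a ((d , b) ∷ Z) with b ≋? a
... | yes p rewrite L-select g gr a Z | gr p | δ-yes p = rearrange d (g a) (L (δ a) Z)
  where
  rearrange : ∀ d x u → d * x + x * u ≡ x * (d * 1ℚ + u)
  rearrange = solve 3 (λ d x u → (d :* x :+ x :* u) := (x :* (d :* con 1ℚ :+ u))) refl
... | no ¬p rewrite L-select g gr a Z | δ-no ¬p = rearrange d (g a) (L (δ a) Z)
  where
  rearrange : ∀ d x u → x * u ≡ x * (d * 0ℚ + u)
  rearrange = solve 3 (λ d x u → (x :* u) := (x :* (d :* con 0ℚ :+ u))) refl

L-δ-reject-same : ∀ m a Z → m ≋ a → L (δ m) (reject a Z) ≡ 0ℚ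
L-δ-reject-same m a [] e = refl
L-δ-reject-same m a ((d , b) ∷ Z) e with b ≋? a
... | yes _ = L-δ-reject-same m a Z e
... | no ¬p rewrite L-δ-reject-same m a Z e | δ-no {m} {b} (λ q → ¬p (≋-trans q e)) | QP.*-zeroʳ d = refl

L-δ-reject-other : ∀ m a Z → ¬ m ≋ a → L (δ m) (reject a Z) ≡ L (δ m) Z
L-δ-reject-other m a [] ne = refl
L-δ-reject-other m a ((d , b) ∷ Z) ne with b ≋? a
... | yes p rewrite L-δ-reject-other m a Z ne | δ-no {m} {b} (λ q → ne (≋-trans (≋-sym q) p)) | QP.*-zeroʳ d = sym (QP.+-identityˡ _)
... | no ¬p rewrite L-δ-reject-other m a Z ne = refl

length-reject : ∀ a Z → length (reject a Z) ≤ length Z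
length-reject a [] = z≤n
length-reject a ((d , b) ∷ Z) with b ≋? a
... | yes _ = NP.m≤n⇒m≤1+n (length-reject a Z)
... | no _ = s≤s (length-reject a Z)

L-vanishes-fuel : ∀ n g → ≋-Congruent g → ∀ Z → length Z ≤ n → (∀ a → g a * L (δ a) Z ≡ 0ℚ) → L g Z ≡ 0ℚ
L-vanishes-fuel n g gr [] _ hyp = refl
L-vanishes-fuel (suc n) g gr ((c , a) ∷ Z) (s≤s le) hyp =
  begin
    c * g a + L g Z
  ≡⟨ cong (c * g a +_) (L-select-reject g a Z) ⟩
    c * g a + (L g (select a Z) + L g (reject a Z))
  ≡⟨ cong (λ z → c * g a + (z + L g (reject a Z))) (L-select g gr a Z) ⟩
    c * g a + (g a * L (δ a) Z + L g (reject a Z))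
  ≡⟨ rearrange c (g a) (L (δ a) Z) (L g (reject a Z)) ⟩
    g a * (c * 1ℚ + L (δ a) Z) + L g (reject a Z)
  ≡⟨ cong (λ z → g a * (c * z + L (δ a) Z) + L g (reject a Z)) (sym (δ-yes {a} {a} ≋-refl)) ⟩
    g a * L (δ a) ((c , a) ∷ Z) + L g (reject a Z)
  ≡⟨ cong (_+ L g (reject a Z)) (hyp a) ⟩
    0ℚ + L g (reject a Z)
  ≡⟨ QP.+-identityˡ _ ⟩
    L g (reject a Z)
  ≡⟨ L-vanishes-fuel n g gr (reject a Z) (NP.≤-trans (length-reject a Z) le) hyp-reject ⟩
    0ℚ
  ∎
  where
  open ≡-Reasoning
  rearrange : ∀ c x u v → c * x + (x * u + v) ≡ x * (c * 1ℚ + u) + v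
  rearrange = solve 4 (λ c x u v → (c :* x :+ (x :* u :+ v)) := (x :* (c :* con 1ℚ :+ u) :+ v)) refl
  hyp-reject : ∀ b → g b * L (δ b) (reject a Z) ≡ 0ℚ
  hyp-reject b with b ≋? a
  ... | yes p rewrite L-δ-reject-same b a Z p = QP.*-zeroʳ (g b)
  ... | no ¬p rewrite L-δ-reject-other b a Z ¬p = trans
    (sym (cong (g b *_) (trans (cong (λ z → c * z + L (δ b) Z) (δ-no {b} {a} (λ q → ¬p (≋-sym q)))) (trans (cong (_+ L (δ b) Z) (QP.*-zeroʳ c)) (QP.+-identityˡ _)))))
    (hyp b)

L-vanishes : ∀ g → ≋-Congruent g → ∀ Z → (∀ a → g a * coeff Z a ≡ 0ℚ) → L g Z ≡ 0ℚ
L-vanishes g gr Z hyp = L-vanishes-fuel (length Z) g gr Z NP.≤-refl (λ a → trans (cong (g a *_) (sym (coeff≡L Z a))) (hyp a))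

negP : Poly → Poly
negP = scaleP (- 1ℚ)

infix 4 _≈L_
_≈L_ : Poly → Poly → Set
X ≈L Y = ∀ g → ≋-Congruent g → L g X ≡ L g Y

coeff-++ : ∀ P Q m → coeff (P ++ Q) m ≡ coeff P m + coeff Q m
coeff-++ P Q m = trans (coeff≡L (P ++ Q) m) (trans (L-++ (δ m) P Q) (sym (cong₂ _+_ (coeff≡L P m) (coeff≡L Q m))))

coeff-scaleP : ∀ c P m → coeff (scaleP c P) m ≡ c * coeff P m
coeff-scaleP c P m = trans (coeff≡L (scaleP c P) m) (trans (L-scaleP (δ m) c P) (sym (cong (c *_) (coeff≡L P m))))

L-mulMono-congruentˡ : ∀ g → ≋-Congruent g → ∀ Q → ≋-Congruent (λ a → L (λ b → g (mulMono a b)) Q)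
L-mulMono-congruentˡ g gr Q p = L-ext Q (λ b → gr (mulMono-cong p ≋-refl))

L-mulMono-congruentʳ : ∀ g → ≋-Congruent g → ∀ a → ≋-Congruent (λ b → g (mulMono a b))
L-mulMono-congruentʳ g gr a p = gr (mulMono-cong ≋-refl p)

+-assoc-L : ∀ P Q R → ((P ++ Q) ++ R) ≈L (P ++ (Q ++ R))
+-assoc-L P Q R g _ = cong (L g) (LP.++-assoc P Q R)

+-comm-L : ∀ P Q → (P ++ Q) ≈L (Q ++ P)
+-comm-L P Q g _ = trans (L-++ g P Q) (trans (QP.+-comm (L g P) (L g Q)) (sym (L-++ g Q P)))

+-identityʳ-L : ∀ P → (P ++ []) ≈L P
+-identityʳ-L P g _ = cong (L g) (LP.++-identityʳ P)

x+-1x≡0 : ∀ x → x + - 1ℚ * x ≡ 0ℚ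
x+-1x≡0 = solve 1 (λ x → (x :+ con (- 1ℚ) :* x) := (con 0ℚ)) refl

+-inverseˡ-L : ∀ P → (negP P ++ P) ≈L []
+-inverseˡ-L P g _ = trans (L-++ g (negP P) P) (trans (cong (_+ L g P) (L-scaleP g (- 1ℚ) P)) (rearrange (L g P)))
  where
  rearrange : ∀ x → - 1ℚ * x + x ≡ 0ℚ
  rearrange = solve 1 (λ x → (con (- 1ℚ) :* x :+ x) := (con 0ℚ)) refl

+-inverseʳ-L : ∀ P → (P ++ negP P) ≈L []
+-inverseʳ-L P g _ = trans (L-++ g P (negP P)) (trans (cong (L g P +_) (L-scaleP g (- 1ℚ) P)) (x+-1x≡0 (L g P)))

*-assoc-L : ∀ P Q R → ((P *P Q) *P R) ≈L (P *P (Q *P R))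
*-assoc-L P Q R g gr =
  trans (L-* g (P *P Q) R)
  (trans (L-* _ P Q)
  (sym (trans (L-* g P (Q *P R))
       (L-ext P (λ a → trans (L-* _ Q R) (L-ext Q (λ b → L-ext R (λ c → gr (≋-sym (mulMono-assoc a b c))))))))))

*-comm-L : ∀ P Q → (P *P Q) ≈L (Q *P P)
*-comm-L P Q g gr = trans (L-* g P Q) (trans (L-swap (λ a b → g (mulMono a b)) P Q) (trans (L-ext Q (λ b → L-ext P (λ a → gr (mulMono-comm a b)))) (sym (L-* g Q P))))

*-identityˡ-L : ∀ P → (1P *P P) ≈L P
*-identityˡ-L P g gr = trans (L-* g 1P P) (trans (QP.+-identityʳ _) (QP.*-identityˡ _))

*-identityʳ-L : ∀ P → (P *P 1P) ≈L P
*-identityʳ-L P g gr = trans (L-* g P 1P) (L-ext P (λ a → trans (QP.+-identityʳ _) (trans (QP.*-identityˡ _) (gr (mulMono-identityʳ a)))))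

distribˡ-L : ∀ P Q R → (P *P (Q ++ R)) ≈L ((P *P Q) ++ (P *P R))
distribˡ-L P Q R g gr = trans (L-* g P (Q ++ R)) (trans (L-ext P (λ a → L-++ _ Q R)) (trans (L-+ _ _ P)
  (sym (trans (L-++ g (P *P Q) (P *P R)) (cong₂ _+_ (L-* g P Q) (L-* g P R))))))

distribʳ-L : ∀ P Q R → ((Q ++ R) *P P) ≈L ((Q *P P) ++ (R *P P))
distribʳ-L P Q R g gr = trans (L-* g (Q ++ R) P) (trans (L-++ _ Q R)
  (sym (trans (L-++ g (Q *P P) (R *P P)) (cong₂ _+_ (L-* g Q P) (L-* g R P)))))

x+-1y≡0⇒x≡y : ∀ x y → x + - 1ℚ * y ≡ 0ℚ → x ≡ y
x+-1y≡0⇒x≡y x y p = trans (rearrange x y) (trans (cong (_+ y) p) (QP.+-identityˡ y))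
  where
  rearrange : ∀ x y → x ≡ (x + - 1ℚ * y) + y
  rearrange = solve 2 (λ x y → x := (x :+ con (- 1ℚ) :* y) :+ y) refl

-- The polynomial ring and its truncations

-- Agreement of coefficients on a set S of monomials that is closed under divisors is a congruence:
-- S = all monomials gives equality of polynomials, S = {t-degree ≤ N} equality modulo t^{N+1}.
module AgreeOn (S : Mono → Set) (S? : ∀ m → Dec (S m))
              (S-cong : ∀ {a b} → a ≋ b → S a → S b)
              (S-factorˡ : ∀ a b → S (mulMono a b) → S a)
              (S-factorʳ : ∀ a b → S (mulMono a b) → S b) where

  infix 4 _≈S_
  record _≈S_ (P Q : Poly) : Set where
    constructor mk≈
    field get : ∀ m → S m → coeff P m ≡ coeff Q m
  open _≈S_ public

  ≈L⇒≈S : ∀ X Y → X ≈L Y → X ≈S Y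
  ≈L⇒≈S X Y e = mk≈ λ m _ → trans (coeff≡L X m) (trans (e (δ m) (δ-cong m)) (sym (coeff≡L Y m)))

  ≈S-refl : ∀ {X} → X ≈S X
  ≈S-refl = mk≈ λ m _ → refl
  ≈S-sym : ∀ {X Y} → X ≈S Y → Y ≈S X
  ≈S-sym e = mk≈ λ m s → sym (get e m s)
  ≈S-trans : ∀ {X Y Z} → X ≈S Y → Y ≈S Z → X ≈S Z
  ≈S-trans e f = mk≈ λ m s → trans (get e m s) (get f m s)

  L-cong : ∀ g → ≋-Congruent g → (∀ a → ¬ S a → g a ≡ 0ℚ) → ∀ {P Q} → P ≈S Q → L g P ≡ L g Q
  L-cong g gr gz {P} {Q} e = x+-1y≡0⇒x≡y (L g P) (L g Q) (trans (sym (trans (L-++ g P (negP Q)) (cong (L g P +_) (L-scaleP g (- 1ℚ) Q)))) (L-vanishes g gr (P ++ negP Q) difference-vanishes))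
    where
    difference-vanishes : ∀ a → g a * coeff (P ++ negP Q) a ≡ 0ℚ
    difference-vanishes a with S? a
    ... | yes s = trans (cong (g a *_) (trans (coeff-++ P (negP Q) a)
        (trans (cong (coeff P a +_) (coeff-scaleP (- 1ℚ) Q a)) (trans (cong (λ z → coeff P a + - 1ℚ * z) (sym (get e a s))) (x+-1x≡0 (coeff P a))))))
        (QP.*-zeroʳ (g a))
    ... | no ns = trans (cong (_* coeff (P ++ negP Q) a) (gz a ns)) (QP.*-zeroˡ (coeff (P ++ negP Q) a))

  +-cong : ∀ {P P' Q Q'} → P ≈S P' → Q ≈S Q' → (P ++ Q) ≈S (P' ++ Q')
  +-cong {P} {P'} {Q} {Q'} e f = mk≈ λ m s → trans (coeff-++ P Q m) (trans (cong₂ _+_ (get e m s) (get f m s)) (sym (coeff-++ P' Q' m)))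

  neg-cong : ∀ {P Q} → P ≈S Q → negP P ≈S negP Q
  neg-cong {P} {Q} e = mk≈ λ m s → trans (coeff-scaleP (- 1ℚ) P m) (trans (cong ((- 1ℚ) *_) (get e m s)) (sym (coeff-scaleP (- 1ℚ) Q m)))

  scaleP-cong : ∀ c {P Q} → P ≈S Q → scaleP c P ≈S scaleP c Q
  scaleP-cong c {P} {Q} e = mk≈ λ m s → trans (coeff-scaleP c P m) (trans (cong (c *_) (get e m s)) (sym (coeff-scaleP c Q m)))

  *-cong : ∀ {P P' Q Q'} → P ≈S P' → Q ≈S Q' → (P *P Q) ≈S (P' *P Q')
  *-cong {P} {P'} {Q} {Q'} e f = mk≈ λ m s → coeff-*P-cong e f m s
    where
    coeff-*P-cong : P ≈S P' → Q ≈S Q' → ∀ m → S m → coeff (P *P Q) m ≡ coeff (P' *P Q') m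
    coeff-*P-cong e f m s = trans (coeff≡L (P *P Q) m) (trans (L-* (δ m) P Q)
      (trans (L-cong _ (L-mulMono-congruentˡ (δ m) (δ-cong m) Q) outsideˡ e)
      (trans (L-ext P' (λ a → L-cong _ (L-mulMono-congruentʳ (δ m) (δ-cong m) a) (outsideʳ a) f))
      (sym (trans (coeff≡L (P' *P Q') m) (L-* (δ m) P' Q'))))))
      where
      outsideʳ : ∀ a b → ¬ S b → δ m (mulMono a b) ≡ 0ℚ
      outsideʳ a b nb with mulMono a b ≋? m
      ... | yes p = ⊥-elim (nb (S-factorʳ a b (S-cong (≋-sym p) s)))
      ... | no ¬p = δ-no ¬p
      outsideˡ : ∀ a → ¬ S a → L (λ b → δ m (mulMono a b)) Q ≡ 0ℚ
      outsideˡ a na = trans (L-ext Q outside) (L-0 Q)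
        where
        outside : ∀ b → δ m (mulMono a b) ≡ 0ℚ
        outside b with mulMono a b ≋? m
        ... | yes p = ⊥-elim (na (S-factorˡ a b (S-cong (≋-sym p) s)))
        ... | no ¬p = δ-no ¬p

  isCR : IsCommutativeRing _≈S_ _++_ _*P_ negP [] 1P
  isCR = record
    { isRing = record
      { +-isAbelianGroup = record
        { isGroup = record
          { isMonoid = record
            { isSemigroup = record
              { isMagma = record
                { isEquivalence = record { refl = ≈S-refl ; sym = ≈S-sym ; trans = ≈S-trans }
                ; ∙-cong = +-cong }
              ; assoc = λ P Q R → ≈L⇒≈S ((P ++ Q) ++ R) (P ++ (Q ++ R)) (+-assoc-L P Q R) }
            ; identity = (λ P → ≈S-refl) , (λ P → ≈L⇒≈S (P ++ []) P (+-identityʳ-L P)) }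
          ; inverse = (λ P → ≈L⇒≈S (negP P ++ P) [] (+-inverseˡ-L P)) , (λ P → ≈L⇒≈S (P ++ negP P) [] (+-inverseʳ-L P))
          ; ⁻¹-cong = neg-cong }
        ; comm = λ P Q → ≈L⇒≈S (P ++ Q) (Q ++ P) (+-comm-L P Q) }
      ; *-cong = *-cong
      ; *-assoc = λ P Q R → ≈L⇒≈S ((P *P Q) *P R) (P *P (Q *P R)) (*-assoc-L P Q R)
      ; *-identity = (λ P → ≈L⇒≈S (1P *P P) P (*-identityˡ-L P)) , (λ P → ≈L⇒≈S (P *P 1P) P (*-identityʳ-L P))
      ; distrib = (λ P Q R → ≈L⇒≈S (P *P (Q ++ R)) ((P *P Q) ++ (P *P R)) (distribˡ-L P Q R)) , (λ P Q R → ≈L⇒≈S ((Q ++ R) *P P) ((Q *P P) ++ (R *P P)) (distribʳ-L P Q R)) }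
    ; *-comm = λ P Q → ≈L⇒≈S (P *P Q) (Q *P P) (*-comm-L P Q) }

  ring : CommutativeRing 0ℓ 0ℓ
  ring = record { isCommutativeRing = isCR }

module Full = AgreeOn (λ _ → ⊤) (λ _ → yes tt) (λ _ _ → tt) (λ _ _ _ → tt) (λ _ _ _ → tt)

tExp≤ : ℕ → Mono → Set
tExp≤ N m = tExp m ≤ N

module Trunc (N : ℕ) = AgreeOn (tExp≤ N) (λ m → tExp m NP.≤? N)
  (λ p s → subst (_≤ N) (tExp-cong p) s)
  (λ a b s → NP.≤-trans (NP.m≤m+n (tExp a) (tExp b)) (subst (_≤ N) (tExp-mulMono a b) s))
  (λ a b s → NP.≤-trans (NP.m≤n+m (tExp b) (tExp a)) (subst (_≤ N) (tExp-mulMono a b) s))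

open Full using () renaming (_≈S_ to _≈F_; mk≈ to mkF; get to getF)
module ≈F = CommutativeRing Full.ring

infix 4 _≈[≤_]_
_≈[≤_]_ : Poly → ℕ → Poly → Set
X ≈[≤ N ] Y = Trunc._≈S_ N X Y

module ≈[≤]-Reasoning (N : ℕ) = SetoidReasoning (CommutativeRing.setoid (Trunc.ring N))
open import Algebra.Properties.CommutativeSemigroup ≈F.*-commutativeSemigroup using (interchange)

viaL : ∀ X Y → X ≈L Y → X ≈F Y
viaL = Full.≈L⇒≈S

fromCoeff : ∀ {X Y} → (∀ m → coeff X m ≡ coeff Y m) → X ≈F Y
fromCoeff e = mkF λ m _ → e m

toCoeff : ∀ {X Y} → X ≈F Y → ∀ m → coeff X m ≡ coeff Y m
toCoeff e m = getF e m tt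

L-congF : ∀ g → ≋-Congruent g → ∀ {P Q} → P ≈F Q → L g P ≡ L g Q
L-congF g gr e = Full.L-cong g gr (λ a na → ⊥-elim (na tt)) e

scaleP-cong : ∀ c {X Y} → X ≈F Y → scaleP c X ≈F scaleP c Y
scaleP-cong c e = Full.scaleP-cong c e

scaleP-++ : ∀ c X Y → scaleP c (X ++ Y) ≡ scaleP c X ++ scaleP c Y
scaleP-++ c X Y = LP.map-++ _ X Y

scaleP-scaleP : ∀ c d X → scaleP c (scaleP d X) ≈F scaleP (c * d) X
scaleP-scaleP c d X = viaL _ _ λ g gr → trans (L-scaleP g c (scaleP d X)) (trans (cong (c *_) (L-scaleP g d X)) (trans (sym (QP.*-assoc c d (L g X))) (sym (L-scaleP g (c * d) X))))

-- Plethysm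

^P-cong : ∀ {X Y} e → X ≈F Y → (X ^P e) ≈F (Y ^P e)
^P-cong zero e = ≈F.refl
^P-cong (suc n) e = ≈F.*-cong e (^P-cong n e)

^P-+ : ∀ X a b → (X ^P (a +ℕ b)) ≈F ((X ^P a) *P (X ^P b))
^P-+ X zero b = ≈F.sym (≈F.*-identityˡ (X ^P b))
^P-+ X (suc a) b = ≈F.trans (≈F.*-congˡ {X} (^P-+ X a b)) (≈F.sym (≈F.*-assoc X (X ^P a) (X ^P b)))

1P-^P : ∀ e → (1P ^P e) ≈F 1P
1P-^P zero = ≈F.refl
1P-^P (suc e) = ≈F.trans (≈F.*-identityˡ (1P ^P e)) (1P-^P e)

pk-cong : ∀ k {X Y} → X ≈F Y → pk k X ≈F pk k Y
pk-cong k {X} {Y} e = fromCoeff λ m → trans (coeff≡L (pk k X) m) (trans (L-pk (δ m) k X)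
  (trans (L-congF (λ a → δ m (pkMono k a)) (λ {a} {b} p → δ-cong m (pkMono-cong k a b p)) e) (sym (trans (coeff≡L (pk k Y) m) (L-pk (δ m) k Y)))))

pk-+P : ∀ k X Y → pk k (X ++ Y) ≡ pk k X ++ pk k Y
pk-+P k X Y = LP.map-++ _ X Y

plethMonoFrom-[]≋ : ∀ i es C → [] ≋ es → plethMonoFrom i es C ≈F 1P
plethMonoFrom-[]≋ i [] C p = ≈F.refl
plethMonoFrom-[]≋ i (e ∷ es) C p rewrite sym ([]≋-head p) = ≈F.trans (≈F.*-identityˡ (plethMonoFrom (suc i) es C)) (plethMonoFrom-[]≋ (suc i) es C ([]≋-tail p))

plethMonoFrom-cong≋ : ∀ i a b C → a ≋ b → plethMonoFrom i a C ≈F plethMonoFrom i b C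
plethMonoFrom-cong≋ i [] b C p = ≈F.sym (plethMonoFrom-[]≋ i b C p)
plethMonoFrom-cong≋ i (e ∷ es) [] C p = plethMonoFrom-[]≋ i (e ∷ es) C (≋-sym p)
plethMonoFrom-cong≋ i (e ∷ es) (e' ∷ es') C p rewrite ≋-head p = ≈F.*-congˡ {pk i C ^P e'} (plethMonoFrom-cong≋ (suc i) es es' C (≋-tail p))

plethMono-cong≋ : ∀ a b C → a ≋ b → plethMono a C ≈F plethMono b C
plethMono-cong≋ [] [] C p = ≈F.refl
plethMono-cong≋ [] (e ∷ es) C p rewrite sym ([]≋-head p) = ≈F.sym (≈F.trans (≈F.*-identityˡ (plethMonoFrom 1 es C)) (plethMonoFrom-[]≋ 1 es C ([]≋-tail p)))
plethMono-cong≋ (e ∷ es) [] C p rewrite sym ([]≋-head (≋-sym p)) = ≈F.trans (≈F.*-identityˡ (plethMonoFrom 1 es C)) (plethMonoFrom-[]≋ 1 es C ([]≋-tail (≋-sym p)))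
plethMono-cong≋ (e ∷ es) (e' ∷ es') C p rewrite ≋-head p = ≈F.*-congˡ {tP ^P e'} (plethMonoFrom-cong≋ 1 es es' C (≋-tail p))

plethMonoFrom-mulMono : ∀ i a b C → plethMonoFrom i (mulMono a b) C ≈F (plethMonoFrom i a C *P plethMonoFrom i b C)
plethMonoFrom-mulMono i [] b C = ≈F.sym (≈F.*-identityˡ (plethMonoFrom i b C))
plethMonoFrom-mulMono i (x ∷ a) [] C = ≈F.sym (≈F.*-identityʳ (plethMonoFrom i (x ∷ a) C))
plethMonoFrom-mulMono i (x ∷ a) (y ∷ b) C =
  ≈F.trans (≈F.*-cong (^P-+ (pk i C) x y) (plethMonoFrom-mulMono (suc i) a b C))
  (interchange (pk i C ^P x) (pk i C ^P y) (plethMonoFrom (suc i) a C) (plethMonoFrom (suc i) b C))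

plethMono-mulMono : ∀ a b C → plethMono (mulMono a b) C ≈F (plethMono a C *P plethMono b C)
plethMono-mulMono [] b C = ≈F.sym (≈F.*-identityˡ (plethMono b C))
plethMono-mulMono (x ∷ a) [] C = ≈F.sym (≈F.*-identityʳ (plethMono (x ∷ a) C))
plethMono-mulMono (x ∷ a) (y ∷ b) C = ≈F.trans (≈F.*-cong (^P-+ tP x y) (plethMonoFrom-mulMono 1 a b C)) (interchange (tP ^P x) (tP ^P y) (plethMonoFrom 1 a C) (plethMonoFrom 1 b C))

plethMonoFrom-cong : ∀ i a {C C'} → C ≈F C' → plethMonoFrom i a C ≈F plethMonoFrom i a C'
plethMonoFrom-cong i [] e = ≈F.refl
plethMonoFrom-cong i (x ∷ a) e = ≈F.*-cong (^P-cong x (pk-cong i e)) (plethMonoFrom-cong (suc i) a e)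

plethMono-cong : ∀ a {C C'} → C ≈F C' → plethMono a C ≈F plethMono a C'
plethMono-cong [] e = ≈F.refl
plethMono-cong (x ∷ a) e = ≈F.*-congˡ {tP ^P x} (plethMonoFrom-cong 1 a e)

plethMonoFrom-var : ∀ i r C → plethMonoFrom i (replicate r 0 ++ (1 ∷ [])) C ≈F pk (r +ℕ i) C
plethMonoFrom-var i zero C = ≈F.trans (≈F.*-identityʳ (pk i C ^P 1)) (≈F.*-identityʳ (pk i C))
plethMonoFrom-var i (suc r) C =
  ≈F.trans (≈F.*-identityˡ (plethMonoFrom (suc i) (replicate r 0 ++ (1 ∷ [])) C))
  (subst (λ z → plethMonoFrom (suc i) (replicate r 0 ++ (1 ∷ [])) C ≈F pk z C) (NP.+-suc r i) (plethMonoFrom-var (suc i) r C))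

plethMono-var : ∀ j C → plethMono (varPow (suc j) 1) C ≈F pk (suc j) C
plethMono-var j C =
  ≈F.trans (≈F.*-identityˡ (plethMonoFrom 1 (replicate j 0 ++ (1 ∷ [])) C))
  (subst (λ z → plethMonoFrom 1 (replicate j 0 ++ (1 ∷ [])) C ≈F pk z C) (NP.+-comm j 1) (plethMonoFrom-var 1 j C))

L-agree : ∀ g g' → ≋-Congruent g → ≋-Congruent g' → ∀ X → (∀ a → g a ≡ g' a ⊎ coeff X a ≡ 0ℚ) → L g X ≡ L g' X
L-agree g g' gr gr' X agree = x+-1y≡0⇒x≡y (L g X) (L g' X)
  (trans (sym (trans (L-+ g (λ a → - 1ℚ * g' a) X) (cong (L g X +_) (L-scaleFun (- 1ℚ) g' X))))
  (L-vanishes difference difference-cong X difference-vanishes))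
  where
  difference : Mono → ℚ
  difference a = g a + - 1ℚ * g' a
  difference-cong : ≋-Congruent difference
  difference-cong p = cong₂ (λ x y → x + - 1ℚ * y) (gr p) (gr' p)
  difference-vanishes : ∀ a → difference a * coeff X a ≡ 0ℚ
  difference-vanishes a with agree a
  ... | inj₁ e = trans (cong (λ z → (g a + - 1ℚ * z) * coeff X a) (sym e)) (trans (cong (_* coeff X a) (x+-1x≡0 (g a))) (QP.*-zeroˡ (coeff X a)))
  ... | inj₂ z = trans (cong (difference a *_) z) (QP.*-zeroʳ (difference a))

L-pleth : ∀ g F C → L g (pleth F C) ≡ L (λ a → L g (plethMono a C)) F
L-pleth g [] C = refl
L-pleth g ((c , a) ∷ F) C = trans (L-++ g (scaleP c (plethMono a C)) (pleth F C)) (cong₂ _+_ (L-scaleP g c (plethMono a C)) (L-pleth g F C))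

L-plethMono-congruent : ∀ g → ≋-Congruent g → ∀ C → ≋-Congruent (λ a → L g (plethMono a C))
L-plethMono-congruent g gr C {a} {b} p = L-congF g gr (plethMono-cong≋ a b C p)

pleth-congˡ : ∀ {F F'} C → F ≈F F' → pleth F C ≈F pleth F' C
pleth-congˡ {F} {F'} C e = mkF λ m _ → trans (coeff≡L (pleth F C) m) (trans (L-pleth (δ m) F C)
  (trans (L-congF _ (L-plethMono-congruent (δ m) (δ-cong m) C) e) (sym (trans (coeff≡L (pleth F' C) m) (L-pleth (δ m) F' C)))))

pleth-congʳ : ∀ F {C C'} → C ≈F C' → pleth F C ≈F pleth F C'
pleth-congʳ F {C} {C'} e = viaL _ _ λ g gr → trans (L-pleth g F C) (trans (L-ext F (λ a → L-congF g gr (plethMono-cong a e))) (sym (L-pleth g F C')))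

pleth-single : ∀ c a C → pleth ((c , a) ∷ []) C ≈F scaleP c (plethMono a C)
pleth-single c a C = ≈F.+-identityʳ (scaleP c (plethMono a C))

-- t-degrees

-- Val v X means that tᵛ divides X, and Hom d X that X is homogeneous of degree d in t.
record Supp (Q : ℕ → Set) (X : Poly) : Set where
  constructor mkS
  field supp : ∀ m → ¬ Q (tExp m) → coeff X m ≡ 0ℚ
open Supp public

Supp-cong : ∀ {Q X Y} → X ≈F Y → Supp Q X → Supp Q Y
Supp-cong e s = mkS λ m nq → trans (sym (toCoeff e m)) (supp s m nq)

Supp-++ : ∀ {Q X Y} → Supp Q X → Supp Q Y → Supp Q (X ++ Y)
Supp-++ {Q} {X} {Y} s t = mkS λ m nq → trans (coeff-++ X Y m) (trans (cong₂ _+_ (supp s m nq) (supp t m nq)) (QP.+-identityˡ 0ℚ))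

Supp-scale : ∀ {Q X} c → Supp Q X → Supp Q (scaleP c X)
Supp-scale {Q} {X} c s = mkS λ m nq → trans (coeff-scaleP c X m) (trans (cong (c *_) (supp s m nq)) (QP.*-zeroʳ c))

Supp-[] : ∀ {Q} → Supp Q []
Supp-[] = mkS λ m _ → refl

Supp-* : ∀ {Q1 Q2 Q3 : ℕ → Set} → (∀ x → Dec (Q1 x)) → (∀ x → Dec (Q2 x)) → (∀ x y → Q1 x → Q2 y → Q3 (x +ℕ y)) →
         ∀ {X Y} → Supp Q1 X → Supp Q2 Y → Supp Q3 (X *P Y)
Supp-* {Q1} {Q2} {Q3} d1 d2 q {X} {Y} s t = mkS λ m nq →
  trans (coeff≡L (X *P Y) m) (trans (L-* (δ m) X Y) (L-vanishes _ (L-mulMono-congruentˡ (δ m) (δ-cong m) Y) X (vanish-left m nq)))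
  where
  vanish-left : ∀ m → ¬ Q3 (tExp m) → ∀ a → L (λ b → δ m (mulMono a b)) Y * coeff X a ≡ 0ℚ
  vanish-left m nq a with d1 (tExp a)
  ... | no n1 = trans (cong (L (λ b → δ m (mulMono a b)) Y *_) (supp s a n1)) (QP.*-zeroʳ (L (λ b → δ m (mulMono a b)) Y))
  ... | yes y1 = trans (cong (_* coeff X a) (L-vanishes _ (L-mulMono-congruentʳ (δ m) (δ-cong m) a) Y vanish-right)) (QP.*-zeroˡ (coeff X a))
    where
    vanish-right : ∀ b → δ m (mulMono a b) * coeff Y b ≡ 0ℚ
    vanish-right b with d2 (tExp b)
    ... | no n2 = trans (cong (δ m (mulMono a b) *_) (supp t b n2)) (QP.*-zeroʳ (δ m (mulMono a b)))
    ... | yes y2 with mulMono a b ≋? m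
    ...   | yes p = ⊥-elim (nq (subst Q3 (trans (sym (tExp-mulMono a b)) (tExp-cong p)) (q _ _ y1 y2)))
    ...   | no ¬p = trans (cong (_* coeff Y b) (δ-no ¬p)) (QP.*-zeroˡ (coeff Y b))

Supp-pk : ∀ {Q1 Q2 : ℕ → Set} → (∀ x → Dec (Q1 x)) → ∀ k → (∀ x → Q1 x → Q2 (suc k *ℕ x)) → ∀ {C} → Supp Q1 C → Supp Q2 (pk (suc k) C)
Supp-pk {Q1} {Q2} d1 k q {C} s = mkS λ m nq → trans (coeff≡L (pk (suc k) C) m) (trans (L-pk (δ m) (suc k) C) (L-vanishes _ (λ {a} {b} p → δ-cong m (pkMono-cong (suc k) a b p)) C (vanish m nq)))
  where
  vanish : ∀ m → ¬ Q2 (tExp m) → ∀ a → δ m (pkMono (suc k) a) * coeff C a ≡ 0ℚ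
  vanish m nq a with d1 (tExp a)
  ... | no n1 = trans (cong (δ m (pkMono (suc k) a) *_) (supp s a n1)) (QP.*-zeroʳ (δ m (pkMono (suc k) a)))
  ... | yes y1 with pkMono (suc k) a ≋? m
  ...   | yes p = ⊥-elim (nq (subst Q2 (trans (sym (tExp-pkMono k a)) (tExp-cong p)) (q _ y1)))
  ...   | no ¬p = trans (cong (_* coeff C a) (δ-no ¬p)) (QP.*-zeroˡ (coeff C a))

Val : ℕ → Poly → Set
Val v = Supp (v ≤_)

Hom : ℕ → Poly → Set
Hom d = Supp (_≡ d)

Val-* : ∀ {u v X Y} → Val u X → Val v Y → Val (u +ℕ v) (X *P Y)
Val-* {u} {v} = Supp-* (u NP.≤?_) (v NP.≤?_) (λ x y → NP.+-mono-≤)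

Hom-* : ∀ {d e X Y} → Hom d X → Hom e Y → Hom (d +ℕ e) (X *P Y)
Hom-* {d} {e} = Supp-* (ℕ._≟ d) (ℕ._≟ e) (λ x y p q → cong₂ _+ℕ_ p q)

Val-0 : ∀ X → Val 0 X
Val-0 X = mkS λ m n → ⊥-elim (n z≤n)

Hom-1 : Hom 0 1P
Hom-1 = mkS vanish
  where
  vanish : ∀ m → ¬ tExp m ≡ 0 → coeff 1P m ≡ 0ℚ
  vanish m ne with [] ≋? m
  ... | yes p = ⊥-elim (ne (sym (tExp-cong p)))
  ... | no ¬p = trans (coeff≡L 1P m) (trans (cong (λ z → 1ℚ * z + 0ℚ) (δ-no ¬p)) refl)

Val-^ : ∀ {v X} e → Val v X → Val (e *ℕ v) (X ^P e)
Val-^ zero s = Val-0 1P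
Val-^ (suc e) s = Val-* s (Val-^ e s)

Hom-^ : ∀ {d X} e → Hom d X → Hom (e *ℕ d) (X ^P e)
Hom-^ zero s = Hom-1
Hom-^ (suc e) s = Hom-* s (Hom-^ e s)

Val-pk : ∀ {v C} k → Val v C → Val (suc k *ℕ v) (pk (suc k) C)
Val-pk {v} k = Supp-pk (v NP.≤?_) k (λ x le → NP.*-monoʳ-≤ (suc k) le)

Hom-pk : ∀ {d C} k → Hom d C → Hom (suc k *ℕ d) (pk (suc k) C)
Hom-pk {d} k = Supp-pk (ℕ._≟ d) k (λ x p → cong (suc k *ℕ_) p)

Val-weaken : ∀ {u v X} → u ≤ v → Val v X → Val u X
Val-weaken le s = mkS λ m n → supp s m (λ q → n (NP.≤-trans le q))

Hom⇒Val : ∀ {d X} → Hom d X → Val d X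
Hom⇒Val {d} s = mkS λ m n → supp s m (λ q → n (NP.≤-reflexive (sym q)))

Val⇒≈0 : ∀ {N X} → Val (suc N) X → X ≈[≤ N ] []
Val⇒≈0 s = Trunc.mk≈ λ m le → supp s m (λ q → NP.<-irrefl refl (NP.<-≤-trans q le))

≈F⇒≈[≤] : ∀ {N X Y} → X ≈F Y → X ≈[≤ N ] Y
≈F⇒≈[≤] e = Trunc.mk≈ λ m _ → toCoeff e m

-- The coefficient of tⁿ and the specialisation t = 1

decToℚ : ∀ {P : Set} → Dec P → ℚ
decToℚ (yes _) = 1ℚ
decToℚ (no _) = 0ℚ

tIs : ℕ → Mono → ℚ
tIs n a = decToℚ (tExp a ℕ.≟ n)

tIs-no : ∀ {n a} → ¬ tExp a ≡ n → tIs n a ≡ 0ℚ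
tIs-no {n} {a} p with tExp a ℕ.≟ n
... | yes q = ⊥-elim (p q)
... | no _ = refl

tIs-cong : ∀ n → ≋-Congruent (tIs n)
tIs-cong n p = cong (λ z → decToℚ (z ℕ.≟ n)) (tExp-cong p)

L-tCoeff : ∀ g n X → L g (tCoeff n X) ≡ L (λ a → tIs n a * g (dropT a)) X
L-tCoeff g n [] = refl
L-tCoeff g n ((c , m) ∷ P) with tExp m ℕ.≟ n
... | yes p = cong₂ _+_ (cong (c *_) (sym (QP.*-identityˡ (g (dropT m))))) (L-tCoeff g n P)
... | no ¬p = trans (L-tCoeff g n P)
  (sym (trans (cong (λ z → c * z + L (λ a → tIs n a * g (dropT a)) P) (QP.*-zeroˡ (g (dropT m))))
  (trans (cong (_+ L (λ a → tIs n a * g (dropT a)) P) (QP.*-zeroʳ c)) (QP.+-identityˡ _))))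

tIs-congruent : ∀ g → ≋-Congruent g → ∀ n → ≋-Congruent (λ a → tIs n a * g (dropT a))
tIs-congruent g gr n p = cong₂ _*_ (tIs-cong n p) (gr (dropT-cong p))

tCoeff-cong : ∀ n {X Y} → X ≈[≤ n ] Y → tCoeff n X ≈F tCoeff n Y
tCoeff-cong n {X} {Y} e = fromCoeff λ m → trans (coeff≡L (tCoeff n X) m) (trans (L-tCoeff (δ m) n X)
  (trans (Trunc.L-cong n _ (tIs-congruent (δ m) (δ-cong m) n) (λ a na → trans (cong (_* δ m (dropT a)) (tIs-no {n} {a} (λ eq → na (NP.≤-reflexive eq)))) (QP.*-zeroˡ (δ m (dropT a)))) e)
  (sym (trans (coeff≡L (tCoeff n Y) m) (L-tCoeff (δ m) n Y)))))

tCoeff-++ : ∀ n X Y → tCoeff n (X ++ Y) ≈F (tCoeff n X ++ tCoeff n Y)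
tCoeff-++ n X Y = viaL _ _ λ g gr → trans (L-tCoeff g n (X ++ Y)) (trans (L-++ _ X Y) (sym (trans (L-++ g (tCoeff n X) (tCoeff n Y)) (cong₂ _+_ (L-tCoeff g n X) (L-tCoeff g n Y)))))

tCoeff-Hom-other : ∀ {d n X} → Hom d X → ¬ d ≡ n → tCoeff n X ≈F []
tCoeff-Hom-other {d} {n} {X} s ne = fromCoeff λ m → trans (coeff≡L (tCoeff n X) m) (trans (L-tCoeff (δ m) n X) (L-vanishes _ (tIs-congruent (δ m) (δ-cong m) n) X (vanish m)))
  where
  vanish : ∀ m a → tIs n a * δ m (dropT a) * coeff X a ≡ 0ℚ
  vanish m a with tExp a ℕ.≟ d
  ... | yes p = trans (cong (λ z → z * δ m (dropT a) * coeff X a) (tIs-no {n} {a} (λ q → ne (trans (sym p) q)))) (trans (cong (_* coeff X a) (QP.*-zeroˡ (δ m (dropT a)))) (QP.*-zeroˡ (coeff X a)))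
  ... | no ¬p = trans (cong (tIs n a * δ m (dropT a) *_) (supp s a ¬p)) (QP.*-zeroʳ (tIs n a * δ m (dropT a)))

atT1 : Poly → Poly
atT1 = map (λ { (c , a) → (c , dropT a) })

L-atT1 : ∀ g X → L g (atT1 X) ≡ L (λ a → g (dropT a)) X
L-atT1 g [] = refl
L-atT1 g ((c , a) ∷ X) = cong (c * g (dropT a) +_) (L-atT1 g X)

tCoeff-Hom-same : ∀ {n X} → Hom n X → tCoeff n X ≈F atT1 X
tCoeff-Hom-same {n} {X} s = viaL _ _ λ g gr → trans (L-tCoeff g n X) (trans (L-agree _ _ (tIs-congruent g gr n) (λ p → gr (dropT-cong p)) X (agree g)) (sym (L-atT1 g X)))
  where
  agree : ∀ g a → tIs n a * g (dropT a) ≡ g (dropT a) ⊎ coeff X a ≡ 0ℚ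
  agree g a with tExp a ℕ.≟ n
  ... | yes p = inj₁ (QP.*-identityˡ (g (dropT a)))
  ... | no ¬p = inj₂ (supp s a ¬p)

atT1-++ : ∀ X Y → atT1 (X ++ Y) ≡ atT1 X ++ atT1 Y
atT1-++ X Y = LP.map-++ _ X Y

atT1-cong : ∀ {X Y} → X ≈F Y → atT1 X ≈F atT1 Y
atT1-cong {X} {Y} e = fromCoeff λ m → trans (coeff≡L (atT1 X) m) (trans (L-atT1 (δ m) X) (trans (L-congF _ (λ p → δ-cong m (dropT-cong p)) e) (sym (trans (coeff≡L (atT1 Y) m) (L-atT1 (δ m) Y)))))

dropT-mulMono : ∀ a b → dropT (mulMono a b) ≋ mulMono (dropT a) (dropT b)
dropT-mulMono a b = mk≋ λ { zero → trans (exponent-dropT-zero (mulMono a b)) (sym (trans (exponent-mulMono (dropT a) (dropT b) 0) (cong₂ _+ℕ_ (exponent-dropT-zero a) (exponent-dropT-zero b))))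
                      ; (suc i) → trans (exponent-dropT-suc (mulMono a b) i) (trans (exponent-mulMono a b (suc i)) (sym (trans (exponent-mulMono (dropT a) (dropT b) (suc i)) (cong₂ _+ℕ_ (exponent-dropT-suc a i) (exponent-dropT-suc b i))))) }

atT1-*P : ∀ X Y → atT1 (X *P Y) ≈F (atT1 X *P atT1 Y)
atT1-*P X Y = viaL _ _ λ g gr → trans (L-atT1 g (X *P Y))
  (trans (L-* _ X Y)
  (sym (trans (L-* g (atT1 X) (atT1 Y)) (trans (L-atT1 _ X) (L-ext X (λ a → trans (L-atT1 _ Y) (L-ext Y (λ b → gr (≋-sym (dropT-mulMono a b))))))))))

atT1-^P : ∀ X e → atT1 (X ^P e) ≈F (atT1 X ^P e)
atT1-^P X zero = ≈F.refl
atT1-^P X (suc e) = ≈F.trans (atT1-*P X (X ^P e)) (≈F.*-congˡ {atT1 X} (atT1-^P X e))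

atT1-tP : atT1 tP ≈F 1P
atT1-tP = viaL _ _ λ g gr → cong (λ z → 1ℚ * z + 0ℚ) (gr (≋-trans (varPow-zero 0) ≋-refl))

dropT-pkMono : ∀ k a → dropT (pkMono (suc k) a) ≋ pkMono (suc k) (dropT a)
dropT-pkMono k [] = ≋-refl
dropT-pkMono k (e ∷ es) = mk≋ λ { zero → trans (exponent-dropT-zero (pkMono (suc k) (e ∷ es))) (sym (trans (exponent-mulMono (varPow 0 (suc k *ℕ 0)) (pkMonoFrom (suc k) 1 es) 0) (trans (cong₂ _+ℕ_ (NP.*-zeroʳ (suc k)) (exponent0-pkMonoFrom k 0 es)) refl)))
                            ; (suc i) → trans (exponent-dropT-suc (pkMono (suc k) (e ∷ es)) i) (trans (exponent-mulMono (varPow 0 (suc k *ℕ e)) (pkMonoFrom (suc k) 1 es) (suc i)) (sym (exponent-mulMono (varPow 0 (suc k *ℕ 0)) (pkMonoFrom (suc k) 1 es) (suc i)))) }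

atT1-pk : ∀ k X → atT1 (pk (suc k) X) ≈F pk (suc k) (atT1 X)
atT1-pk k X = viaL _ _ λ g gr → trans (L-atT1 g (pk (suc k) X)) (trans (L-pk _ (suc k) X) (sym (trans (L-pk g (suc k) (atT1 X)) (trans (L-atT1 _ X) (L-ext X (λ a → gr (≋-sym (dropT-pkMono k a)))))))) 

atT1-plethMonoFrom : ∀ i es C → atT1 (plethMonoFrom (suc i) es C) ≈F plethMonoFrom (suc i) es (atT1 C)
atT1-plethMonoFrom i [] C = ≈F.refl
atT1-plethMonoFrom i (e ∷ es) C = ≈F.trans (atT1-*P (pk (suc i) C ^P e) (plethMonoFrom (suc (suc i)) es C))
  (≈F.*-cong (≈F.trans (atT1-^P (pk (suc i) C) e) (^P-cong e (atT1-pk i C))) (atT1-plethMonoFrom (suc i) es C))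

atT1-plethMono : ∀ a C → atT1 (plethMono a C) ≈F plethMono (dropT a) (atT1 C)
atT1-plethMono [] C = ≈F.refl
atT1-plethMono (e ∷ es) C = ≈F.trans (atT1-*P (tP ^P e) (plethMonoFrom 1 es C))
  (≈F.*-cong (≈F.trans (atT1-^P tP e) (≈F.trans (^P-cong e atT1-tP) (1P-^P e))) (atT1-plethMonoFrom 0 es C))

atT1-pleth : ∀ F C → atT1 (pleth F C) ≈F pleth (atT1 F) (atT1 C)
atT1-pleth F C = viaL _ _ λ g gr → trans (L-atT1 g (pleth F C)) (trans (L-pleth _ F C)
  (trans (L-ext F (λ a → trans (sym (L-atT1 g (plethMono a C))) (L-congF g gr (atT1-plethMono a C))))
  (sym (trans (L-pleth g (atT1 F) (atT1 C)) (L-atT1 _ F)))))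

atT1-Hom0 : ∀ {X} → Hom 0 X → atT1 X ≈F X
atT1-Hom0 {X} s = viaL _ _ λ g gr → trans (L-atT1 g X) (L-agree _ g (λ p → gr (dropT-cong p)) gr X (agree g gr))
  where
  agree : ∀ g → ≋-Congruent g → ∀ a → g (dropT a) ≡ g a ⊎ coeff X a ≡ 0ℚ
  agree g gr a with tExp a ℕ.≟ 0
  ... | yes p = inj₁ (gr (dropT-tExp0 a p))
  ... | no ¬p = inj₂ (supp s a ¬p)

monoP : Mono → Poly
monoP a = (1ℚ , a) ∷ []

monoP-*P : ∀ a b → (monoP a *P monoP b) ≈F monoP (mulMono a b)
monoP-*P a b = viaL _ _ λ g gr → refl

monoP-cong : ∀ {a b} → a ≋ b → monoP a ≈F monoP b
monoP-cong p = viaL _ _ λ g gr → cong (λ z → 1ℚ * z + 0ℚ) (gr p)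

Hom-monoP : ∀ a → Hom (tExp a) (monoP a)
Hom-monoP a = mkS vanish
  where
  vanish : ∀ m → ¬ tExp m ≡ tExp a → coeff (monoP a) m ≡ 0ℚ
  vanish m ne with a ≋? m
  ... | yes p = ⊥-elim (ne (sym (tExp-cong p)))
  ... | no ¬p = trans (coeff≡L (monoP a) m) (trans (cong (λ z → 1ℚ * z + 0ℚ) (δ-no ¬p)) refl)

tP-^P : ∀ e → (tP ^P e) ≈F monoP (e ∷ [])
tP-^P zero = viaL _ _ λ g gr → cong (λ z → 1ℚ * z + 0ℚ) (gr (≋-sym (varPow-zero 0)))
tP-^P (suc e) = ≈F.trans (≈F.*-congˡ {tP} (tP-^P e)) (monoP-*P (1 ∷ []) (e ∷ []))

pk-p₁ : ∀ i → pk (suc i) (pP 1) ≈F monoP (varPow (suc i) 1)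
pk-p₁ i = monoP-cong (≋-trans (mulMono-cong (≋-trans (varPow-cong 0 (NP.*-zeroʳ (suc i))) (varPow-zero 0))
                                              (≋-trans (mulMono-identityʳ _) (≡⇒≋ (cong (λ v → varPow v 1) (NP.*-identityˡ (suc i))))))
                               (mulMono-identityˡ _))

monoP-varPow-^P : ∀ v e → (monoP (varPow v 1) ^P e) ≈F monoP (varPow v e)
monoP-varPow-^P v zero = monoP-cong (≋-sym (varPow-zero v))
monoP-varPow-^P v (suc e) = ≈F.trans (≈F.*-congˡ {monoP (varPow v 1)} (monoP-varPow-^P v e)) (≈F.trans (monoP-*P (varPow v 1) (varPow v e)) (monoP-cong (≋-sym (varPow-+ v 1 e))))

[]≋replicate0 : ∀ n → [] ≋ replicate n 0
[]≋replicate0 zero = ≋-refl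
[]≋replicate0 (suc n) = mk≋ λ { zero → refl ; (suc j) → at ([]≋replicate0 n) j }

varPow-shift : ∀ n e es → mulMono (varPow n e) (replicate (suc n) 0 ++ es) ≋ (replicate n 0 ++ (e ∷ es))
varPow-shift zero e es = ≋-cons (NP.+-identityʳ e) ≋-refl
varPow-shift (suc n) e es = ≋-cons refl (varPow-shift n e es)

plethMonoFrom-p₁ : ∀ i es → plethMonoFrom (suc i) es (pP 1) ≈F monoP (replicate (suc i) 0 ++ es)
plethMonoFrom-p₁ i [] = monoP-cong (≋-trans ([]≋replicate0 (suc i)) (≋-sym (mk≋ λ j → cong (λ z → exponent z j) (LP.++-identityʳ (replicate (suc i) 0)))))
plethMonoFrom-p₁ i (e ∷ es) = ≈F.trans (≈F.*-cong (≈F.trans (^P-cong e (pk-p₁ i)) (monoP-varPow-^P (suc i) e)) (plethMonoFrom-p₁ (suc i) es))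
  (≈F.trans (monoP-*P (varPow (suc i) e) (replicate (suc (suc i)) 0 ++ es)) (monoP-cong (varPow-shift (suc i) e es)))

plethMono-p₁ : ∀ a → plethMono a (pP 1) ≈F monoP a
plethMono-p₁ [] = ≈F.refl
plethMono-p₁ (e ∷ es) = ≈F.trans (≈F.*-cong (tP-^P e) (plethMonoFrom-p₁ 0 es)) (≈F.trans (monoP-*P (e ∷ []) (0 ∷ es)) (monoP-cong (varPow-shift 0 e es)))

pleth-p₁ : ∀ F → pleth F (pP 1) ≈F F
pleth-p₁ F = viaL _ _ λ g gr → trans (L-pleth g F (pP 1)) (L-ext F (λ a → trans (L-congF g gr (plethMono-p₁ a)) (trans (QP.+-identityʳ _) (QP.*-identityˡ _))))

-- Finite sums and products

opaque
  Σ< : ℕ → (ℕ → Poly) → Poly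
  Σ< zero f = []
  Σ< (suc n) f = f 0 ++ Σ< n (f ∘ suc)

  Π< : ℕ → (ℕ → Poly) → Poly
  Π< zero f = 1P
  Π< (suc n) f = f 0 *P Π< n (f ∘ suc)

  cond : ∀ {P : Set} → Dec P → Poly → Poly
  cond (yes _) x = x
  cond (no _) x = []

module Sums (_≈ₛ_ : Poly → Poly → Set) (isCR : IsCommutativeRing _≈ₛ_ _++_ _*P_ negP [] 1P) where

  private
    ring : CommutativeRing 0ℓ 0ℓ
    ring = record { isCommutativeRing = isCR }
  open CommutativeRing ring hiding (zero; _+_; _*_; -_; 0#; 1#; Carrier) renaming (refl to ≈-refl; sym to ≈-sym; trans to ≈-trans)
  open import Algebra.Properties.CommutativeSemigroup +-commutativeSemigroup using () renaming (interchange to +-interchange)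
  open import Algebra.Properties.CommutativeSemigroup *-commutativeSemigroup using (x∙yz≈y∙xz) renaming (interchange to *-interchange)
  open import Relation.Binary.Reasoning.Setoid setoid

  opaque
    unfolding Σ< Π< cond

    Σ<-0 : ∀ f → Σ< 0 f ≈ []
    Σ<-0 f = ≈-refl

    Σ<-suc : ∀ n f → Σ< (suc n) f ≈ f 0 ++ Σ< n (f ∘ suc)
    Σ<-suc n f = ≈-refl

    Π<-0 : ∀ f → Π< 0 f ≈ 1P
    Π<-0 f = ≈-refl

    Π<-suc : ∀ n f → Π< (suc n) f ≈ f 0 *P Π< n (f ∘ suc)
    Π<-suc n f = ≈-refl

    cond-yes : ∀ {P : Set} (d : Dec P) → P → ∀ x → cond d x ≈ x
    cond-yes (yes _) p x = ≈-refl
    cond-yes (no ¬p) p x = ⊥-elim (¬p p)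

    cond-no : ∀ {P : Set} (d : Dec P) → ¬ P → ∀ x → cond d x ≈ []
    cond-no (yes p) ¬p x = ⊥-elim (¬p p)
    cond-no (no _) ¬p x = ≈-refl

    cond-iff : ∀ {P Q : Set} (d : Dec P) (e : Dec Q) → (P → Q) → (Q → P) → ∀ {x y} → x ≈ y → cond d x ≈ cond e y
    cond-iff (yes p) (yes q) f g xy = xy
    cond-iff (yes p) (no ¬q) f g xy = ⊥-elim (¬q (f p))
    cond-iff (no ¬p) (yes q) f g xy = ⊥-elim (¬p (g q))
    cond-iff (no ¬p) (no ¬q) f g xy = ≈-refl

    cond-cong : ∀ {P : Set} (d : Dec P) {x y} → x ≈ y → cond d x ≈ cond d y
    cond-cong (yes _) xy = xy
    cond-cong (no _) xy = ≈-refl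

    Σ-cong< : ∀ n {f g} → (∀ i → i < n → f i ≈ g i) → Σ< n f ≈ Σ< n g
    Σ-cong< zero e = ≈-refl
    Σ-cong< (suc n) e = +-cong (e 0 (s≤s z≤n)) (Σ-cong< n (λ i lt → e (suc i) (s≤s lt)))

    Σ-vanish : ∀ n {f} → (∀ i → i < n → f i ≈ []) → Σ< n f ≈ []
    Σ-vanish zero e = ≈-refl
    Σ-vanish (suc n) e = ≈-trans (+-cong (e 0 (s≤s z≤n)) (Σ-vanish n (λ i lt → e (suc i) (s≤s lt)))) (+-identityˡ [])

    Σ-+ : ∀ n f g → Σ< n (λ i → f i ++ g i) ≈ Σ< n f ++ Σ< n g
    Σ-+ zero f g = ≈-sym (+-identityˡ [])
    Σ-+ (suc n) f g = ≈-trans (+-congˡ {f 0 ++ g 0} (Σ-+ n (f ∘ suc) (g ∘ suc))) (+-interchange (f 0) (g 0) (Σ< n (f ∘ suc)) (Σ< n (g ∘ suc)))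

    Σ-*ˡ : ∀ n x f → x *P Σ< n f ≈ Σ< n (λ i → x *P f i)
    Σ-*ˡ zero x f = zeroʳ x
    Σ-*ˡ (suc n) x f = ≈-trans (distribˡ x (f 0) (Σ< n (f ∘ suc))) (+-congˡ {x *P f 0} (Σ-*ˡ n x (f ∘ suc)))

    Σ-last : ∀ n f → Σ< (suc n) f ≈ Σ< n f ++ f n
    Σ-last zero f = ≈-trans (+-identityʳ (f 0)) (≈-sym (+-identityˡ (f 0)))
    Σ-last (suc n) f = ≈-trans (+-congˡ {f 0} (Σ-last n (f ∘ suc))) (≈-sym (+-assoc (f 0) (Σ< n (f ∘ suc)) (f (suc n))))

    Σ-swap : ∀ m n (f : ℕ → ℕ → Poly) → Σ< m (λ i → Σ< n (f i)) ≈ Σ< n (λ j → Σ< m (λ i → f i j))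
    Σ-swap zero n f = ≈-sym (Σ-vanish n (λ _ _ → ≈-refl))
    Σ-swap (suc m) n f = ≈-trans (+-congˡ {Σ< n (f 0)} (Σ-swap m n (f ∘ suc))) (≈-sym (Σ-+ n (f 0) (λ j → Σ< m (λ i → f (suc i) j))))

    Σ-extend : ∀ m n f → m ≤ n → (∀ i → m ≤ i → i < n → f i ≈ []) → Σ< m f ≈ Σ< n f
    Σ-extend zero n f le e = ≈-sym (Σ-vanish n (λ i lt → e i z≤n lt))
    Σ-extend (suc m) (suc n) f (s≤s le) e = +-congˡ {f 0} (Σ-extend m n (f ∘ suc) le (λ i le' lt → e (suc i) (s≤s le') (s≤s lt)))

    Π-cong< : ∀ n {f g} → (∀ i → i < n → f i ≈ g i) → Π< n f ≈ Π< n g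
    Π-cong< zero e = ≈-refl
    Π-cong< (suc n) e = *-cong (e 0 (s≤s z≤n)) (Π-cong< n (λ i lt → e (suc i) (s≤s lt)))

    Π-last : ∀ n f → Π< (suc n) f ≈ Π< n f *P f n
    Π-last zero f = ≈-trans (*-identityʳ (f 0)) (≈-sym (*-identityˡ (f 0)))
    Π-last (suc n) f = ≈-trans (*-congˡ {f 0} (Π-last n (f ∘ suc))) (≈-sym (*-assoc (f 0) (Π< n (f ∘ suc)) (f (suc n))))

    Π-* : ∀ n f g → Π< n (λ i → f i *P g i) ≈ Π< n f *P Π< n g
    Π-* zero f g = ≈-sym (*-identityˡ 1P)
    Π-* (suc n) f g = ≈-trans (*-congˡ {f 0 *P g 0} (Π-* n (f ∘ suc) (g ∘ suc))) (*-interchange (f 0) (g 0) (Π< n (f ∘ suc)) (Π< n (g ∘ suc)))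

    Π-1 : ∀ n → Π< n (λ _ → 1P) ≈ 1P
    Π-1 zero = ≈-refl
    Π-1 (suc n) = ≈-trans (*-identityˡ (Π< n (λ _ → 1P))) (Π-1 n)

    Π-extract : ∀ n i → i < n → ∀ f g X → (∀ j → j < n → ¬ j ≡ i → f j ≈ g j) → f i ≈ X *P g i →
                Π< n f ≈ X *P Π< n g
    Π-extract (suc n) zero _ f g X e fi = begin
      f 0 *P Π< n (f ∘ suc)         ≈⟨ *-cong fi (Π-cong< n (λ j lt → e (suc j) (s≤s lt) λ ())) ⟩
      (X *P g 0) *P Π< n (g ∘ suc)  ≈⟨ *-assoc X (g 0) (Π< n (g ∘ suc)) ⟩
      X *P (g 0 *P Π< n (g ∘ suc))  ∎
    Π-extract (suc n) (suc i) (s≤s lt) f g X e fi = begin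
      f 0 *P Π< n (f ∘ suc)         ≈⟨ *-cong (e 0 (s≤s z≤n) λ ()) (Π-extract n i lt (f ∘ suc) (g ∘ suc) X e′ fi) ⟩
      g 0 *P (X *P Π< n (g ∘ suc))  ≈⟨ x∙yz≈y∙xz (g 0) X (Π< n (g ∘ suc)) ⟩
      X *P (g 0 *P Π< n (g ∘ suc))  ∎
      where
      e′ : ∀ j → j < n → ¬ j ≡ i → f (suc j) ≈ g (suc j)
      e′ j lt′ j≢i = e (suc j) (s≤s lt′) (j≢i ∘ NP.suc-injective)

  Σ-cong : ∀ n {f g} → (∀ i → f i ≈ g i) → Σ< n f ≈ Σ< n g
  Σ-cong n e = Σ-cong< n (λ i _ → e i)

  Σ-*ʳ : ∀ n x f → Σ< n f *P x ≈ Σ< n (λ i → f i *P x)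
  Σ-*ʳ n x f = ≈-trans (*-comm _ x) (≈-trans (Σ-*ˡ n x f) (Σ-cong n (λ i → *-comm x (f i))))

  Σ-*-Σ : ∀ m n f g → Σ< m f *P Σ< n g ≈ Σ< m (λ i → Σ< n (λ j → f i *P g j))
  Σ-*-Σ m n f g = ≈-trans (Σ-*ʳ m (Σ< n g) f) (Σ-cong m (λ i → Σ-*ˡ n (f i) g))

  Σ-shift : ∀ s L (H : ℕ → Poly) → Σ< L (λ m → cond (s NP.≤? m) (H (m ∸ s))) ≈ Σ< L (λ b → cond (s +ℕ b NP.<? L) (H b))
  Σ-shift zero L H = Σ-cong< L (λ i lt → cond-iff (0 NP.≤? i) (i NP.<? L) (λ _ → lt) (λ _ → z≤n) ≈-refl)
  Σ-shift (suc s) zero H = ≈-trans (Σ<-0 _) (≈-sym (Σ<-0 _))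
  Σ-shift (suc s) (suc L) H = begin
    Σ< (suc L) (λ m → cond (suc s NP.≤? m) (H (m ∸ suc s)))
      ≈⟨ Σ<-suc L _ ⟩
    cond (suc s NP.≤? 0) (H 0) ++ Σ< L (λ m → cond (suc s NP.≤? suc m) (H (m ∸ s)))
      ≈⟨ +-cong (cond-no (suc s NP.≤? 0) (λ ()) _) (Σ-cong L (λ m → cond-iff (suc s NP.≤? suc m) (s NP.≤? m) NP.≤-pred s≤s ≈-refl)) ⟩
    [] ++ Σ< L (λ m → cond (s NP.≤? m) (H (m ∸ s)))
      ≈⟨ ≈-trans (+-identityˡ _) (Σ-shift s L H) ⟩
    Σ< L (λ b → cond (s +ℕ b NP.<? L) (H b))
      ≈⟨ Σ-extend L (suc L) _ (NP.n≤1+n L) (λ i le lt → cond-no (s +ℕ i NP.<? L) (λ q → NP.<-irrefl refl (NP.<-≤-trans q (NP.≤-trans le (NP.m≤n+m i s)))) _) ⟩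
    Σ< (suc L) (λ b → cond (s +ℕ b NP.<? L) (H b))
      ≈⟨ Σ-cong (suc L) (λ b → cond-iff (s +ℕ b NP.<? L) (suc s +ℕ b NP.<? suc L) s≤s NP.≤-pred ≈-refl) ⟩
    Σ< (suc L) (λ b → cond (suc s +ℕ b NP.<? suc L) (H b)) ∎

  Σ-triangle : ∀ k N (G : ℕ → ℕ → Poly) →
    Σ< (suc N) (λ m → Σ< (suc m) (λ a → cond (a *ℕ suc k NP.≤? m) (G a (m ∸ a *ℕ suc k))))
    ≈ Σ< (suc N) (λ a → Σ< (suc N) (λ b → cond (a *ℕ suc k +ℕ b NP.≤? N) (G a b)))
  Σ-triangle k N G = begin
    Σ< (suc N) (λ m → Σ< (suc m) (λ a → cond (a *ℕ suc k NP.≤? m) (G a (m ∸ a *ℕ suc k))))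
      ≈⟨ Σ-cong< (suc N) (λ m lt → Σ-extend (suc m) (suc N) _ lt (λ a le lt′ → cond-no (a *ℕ suc k NP.≤? m) (λ q → NP.<-irrefl refl (NP.<-≤-trans le (NP.≤-trans (NP.m≤m*n a (suc k)) q))) _)) ⟩
    Σ< (suc N) (λ m → Σ< (suc N) (λ a → cond (a *ℕ suc k NP.≤? m) (G a (m ∸ a *ℕ suc k))))
      ≈⟨ Σ-swap (suc N) (suc N) _ ⟩
    Σ< (suc N) (λ a → Σ< (suc N) (λ m → cond (a *ℕ suc k NP.≤? m) (G a (m ∸ a *ℕ suc k))))
      ≈⟨ Σ-cong (suc N) (λ a → Σ-shift (a *ℕ suc k) (suc N) (G a)) ⟩
    Σ< (suc N) (λ a → Σ< (suc N) (λ b → cond (a *ℕ suc k +ℕ b NP.<? suc N) (G a b)))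
      ≈⟨ Σ-cong (suc N) (λ a → Σ-cong (suc N) (λ b → cond-iff (a *ℕ suc k +ℕ b NP.<? suc N) (a *ℕ suc k +ℕ b NP.≤? N) NP.≤-pred s≤s ≈-refl)) ⟩
    Σ< (suc N) (λ a → Σ< (suc N) (λ b → cond (a *ℕ suc k +ℕ b NP.≤? N) (G a b))) ∎

open Sums Full._≈S_ Full.isCR
module ST (N : ℕ) = Sums (Trunc._≈S_ N) (Trunc.isCR N)

sumP-applyUpTo : ∀ (f : ℕ → Poly) (g : ℕ → ℕ) n → sumP (map f (applyUpTo g n)) ≈F Σ< n (f ∘ g)
sumP-applyUpTo f g zero = ≈F.sym (Σ<-0 _)
sumP-applyUpTo f g (suc n) = ≈F.trans (≈F.+-congˡ {f (g 0)} (sumP-applyUpTo f (g ∘ suc) n)) (≈F.sym (Σ<-suc n (f ∘ g)))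

prodP-applyUpTo : ∀ (f : ℕ → Poly) (g : ℕ → ℕ) n → prodP (map f (applyUpTo g n)) ≈F Π< n (f ∘ g)
prodP-applyUpTo f g zero = ≈F.sym (Π<-0 _)
prodP-applyUpTo f g (suc n) = ≈F.trans (≈F.*-congˡ {f (g 0)} (prodP-applyUpTo f (g ∘ suc) n)) (≈F.sym (Π<-suc n (f ∘ g)))

-- Partitions

Par : ℕ → ℕ → List (List ℕ)
Par n k = partsFuel (n +ℕ k) n k

private
  +-suc-≤ : ∀ {n k f} → n +ℕ suc k ≤ f → suc n +ℕ k ≤ f
  +-suc-≤ {n} {k} {f} = subst (_≤ f) (NP.+-suc n k)

  ∸-+-suc-≤ : ∀ {n k f} → k ≤ n → n +ℕ suc k ≤ f → n ∸ k +ℕ suc k ≤ f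
  ∸-+-suc-≤ {n} {k} k≤n le = NP.≤-trans (NP.≤-reflexive (trans (NP.+-suc (n ∸ k) k) (cong suc (NP.m∸n+n≡m k≤n))))
                                        (NP.≤-trans (s≤s (NP.m≤m+n n k)) (+-suc-≤ le))

partsFuel-fuel : ∀ f f′ n k → n +ℕ k ≤ f → n +ℕ k ≤ f′ → partsFuel f n k ≡ partsFuel f′ n k
partsFuel-fuel f f′ zero k _ _ = refl
partsFuel-fuel (suc f) (suc f′) (suc n) zero _ _ = refl
partsFuel-fuel (suc f) (suc f′) (suc n) (suc k) (s≤s le) (s≤s le′) with suc k ℕ.≤? suc n
... | yes (s≤s k≤n) = cong₂ _++_ (partsFuel-fuel f f′ (suc n) k (+-suc-≤ le) (+-suc-≤ le′))
                                (cong (map (suc k ∷_)) (partsFuel-fuel f f′ (n ∸ k) (suc k) (∸-+-suc-≤ k≤n le) (∸-+-suc-≤ k≤n le′)))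
... | no _ = partsFuel-fuel f f′ (suc n) k (+-suc-≤ le) (+-suc-≤ le′)

Par-split : ∀ n k → suc k ≤ suc n → Par (suc n) (suc k) ≡ Par (suc n) k ++ map (suc k ∷_) (Par (n ∸ k) (suc k))
Par-split n k le with suc k ℕ.≤? suc n
... | yes (s≤s k≤n) = cong₂ _++_ (partsFuel-fuel _ _ (suc n) k (NP.≤-reflexive (sym (NP.+-suc n k))) NP.≤-refl)
                                (cong (map (suc k ∷_)) (partsFuel-fuel _ _ (n ∸ k) (suc k) (∸-+-suc-≤ k≤n NP.≤-refl) NP.≤-refl))
... | no k≰n = ⊥-elim (k≰n le)

Par-skip : ∀ n k → ¬ suc k ≤ suc n → Par (suc n) (suc k) ≡ Par (suc n) k
Par-skip n k k≰n with suc k ℕ.≤? suc n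
... | yes k≤n = ⊥-elim (k≰n k≤n)
... | no _ = partsFuel-fuel _ _ (suc n) k (NP.≤-reflexive (sym (NP.+-suc n k))) NP.≤-refl

Par-≥ : ∀ n k → n ≤ k → Par n k ≡ Par n n
Par-≥ zero k le = refl
Par-≥ (suc n) (suc k) (s≤s le) with NP.m≤n⇒m<n∨m≡n le
... | inj₂ refl = refl
... | inj₁ lt = trans (Par-skip n k (λ { (s≤s q) → NP.<-irrefl refl (NP.<-≤-trans lt q) })) (Par-≥ (suc n) k lt)

PartsIn : ℕ → List ℕ → Set
PartsIn k = All (λ j → 1 ≤ j × j ≤ k)

PartsIn-mono : ∀ {k k′ l} → k ≤ k′ → PartsIn k l → PartsIn k′ l
PartsIn-mono le = All.map (λ { (pos , bound) → pos , NP.≤-trans bound le })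

partsFuel-PartsIn : ∀ f n k → All (PartsIn k) (partsFuel f n k)
partsFuel-PartsIn _ zero _ = [] ∷ []
partsFuel-PartsIn zero (suc _) _ = []
partsFuel-PartsIn (suc f) (suc n) zero = []
partsFuel-PartsIn (suc f) (suc n) (suc k) with suc k ℕ.≤? suc n
... | yes _ = All.++⁺ (All.map (PartsIn-mono (NP.n≤1+n k)) (partsFuel-PartsIn f (suc n) k))
                      (All.map⁺ (All.map ((s≤s z≤n , NP.≤-refl) ∷_) (partsFuel-PartsIn f (suc n ∸ suc k) (suc k))))
... | no _ = All.map (PartsIn-mono (NP.n≤1+n k)) (partsFuel-PartsIn f (suc n) k)

Par-PartsIn : ∀ n k → All (PartsIn k) (Par n k)
Par-PartsIn n k = partsFuel-PartsIn (n +ℕ k) n k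

ΣL : List (List ℕ) → (List ℕ → Poly) → Poly
ΣL ls F = sumP (map F ls)

sumP-++ : ∀ xs ys → sumP (xs ++ ys) ≡ sumP xs ++ sumP ys
sumP-++ [] ys = refl
sumP-++ (x ∷ xs) ys = trans (cong (x ++_) (sumP-++ xs ys)) (sym (LP.++-assoc x (sumP xs) (sumP ys)))

ΣL-++ : ∀ xs ys F → ΣL (xs ++ ys) F ≡ ΣL xs F ++ ΣL ys F
ΣL-++ xs ys F = trans (cong sumP (LP.map-++ F xs ys)) (sumP-++ (map F xs) (map F ys))

ΣL-map : ∀ (g : List ℕ → List ℕ) xs F → ΣL (map g xs) F ≡ ΣL xs (F ∘ g)
ΣL-map g [] F = refl
ΣL-map g (x ∷ xs) F = cong (F (g x) ++_) (ΣL-map g xs F)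

ΣL-cong : ∀ {A : List ℕ → Set} {xs F G} → All A xs → (∀ l → A l → F l ≈F G l) → ΣL xs F ≈F ΣL xs G
ΣL-cong [] e = ≈F.refl
ΣL-cong (a ∷ as) e = ≈F.+-cong (e _ a) (ΣL-cong as e)

ΣL-*ˡ : ∀ xs X F → ΣL xs (λ l → X *P F l) ≈F (X *P ΣL xs F)
ΣL-*ˡ [] X F = ≈F.sym (≈F.zeroʳ X)
ΣL-*ˡ (x ∷ xs) X F = ≈F.trans (≈F.+-congˡ {X *P F x} (ΣL-*ˡ xs X F)) (≈F.sym (≈F.distribˡ X (F x) (ΣL xs F)))

Supp-ΣL : ∀ {Q} {A : List ℕ → Set} {xs F} → All A xs → (∀ l → A l → Supp Q (F l)) → Supp Q (ΣL xs F)
Supp-ΣL [] s = Supp-[]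
Supp-ΣL (a ∷ as) s = Supp-++ (s _ a) (Supp-ΣL as s)

ΣPar-prefixed : (List ℕ → Poly) → ℕ → ℕ → ℕ → Poly
ΣPar-prefixed F K a r = ΣL (Par r K) (F ∘ (replicate a (suc K) ++_))

ΣPar-split : ∀ m K F → suc K ≤ suc m →
             ΣL (Par (suc m) (suc K)) F ≡ ΣL (Par (suc m) K) F ++ ΣL (Par (m ∸ K) (suc K)) (F ∘ (suc K ∷_))
ΣPar-split m K F le = trans (cong (λ ls → ΣL ls F) (Par-split m K le))
                        (trans (ΣL-++ (Par (suc m) K) _ F) (cong (ΣL (Par (suc m) K) F ++_) (ΣL-map (suc K ∷_) (Par (m ∸ K) (suc K)) F)))

Σ-multiplicity-shift : ∀ K m → K ≤ m → (G : ℕ → ℕ → Poly) →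
  Σ< (suc (m ∸ K)) (λ a → cond (a *ℕ suc K NP.≤? m ∸ K) (G (suc a) (m ∸ K ∸ a *ℕ suc K)))
  ≈F Σ< (suc m) (λ a → cond (suc a *ℕ suc K NP.≤? suc m) (G (suc a) (suc m ∸ suc a *ℕ suc K)))
Σ-multiplicity-shift K m K≤m G =
  ≈F.trans (Σ-cong< (suc r) (λ a _ → cond-iff (a *ℕ s NP.≤? r) (suc a *ℕ s NP.≤? suc m) (fwd a) (bwd a) (≈F.reflexive (cong (G (suc a)) (∸-shift a)))))
           (Σ-extend (suc r) (suc m) _ (s≤s (NP.m∸n≤m m K)) (λ a ge _ → cond-no (suc a *ℕ s NP.≤? suc m) (too-big a ge) _))
  where
  s = suc K
  r = m ∸ K
  r+s≡1+m : r +ℕ s ≡ suc m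
  r+s≡1+m = trans (NP.+-suc r K) (cong suc (NP.m∸n+n≡m K≤m))
  fwd : ∀ a → a *ℕ s ≤ r → suc a *ℕ s ≤ suc m
  fwd a le = NP.≤-trans (NP.+-monoʳ-≤ s le) (NP.≤-reflexive (trans (NP.+-comm s r) r+s≡1+m))
  bwd : ∀ a → suc a *ℕ s ≤ suc m → a *ℕ s ≤ r
  bwd a le = NP.+-cancelˡ-≤ s (a *ℕ s) r (NP.≤-trans le (NP.≤-reflexive (sym (trans (NP.+-comm s r) r+s≡1+m))))
  ∸-shift : ∀ a → r ∸ a *ℕ s ≡ suc m ∸ suc a *ℕ s
  ∸-shift a = trans (cong (_∸ a *ℕ s) (sym (NP.m+n∸n≡m r s))) (trans (NP.∸-+-assoc (r +ℕ s) s (a *ℕ s)) (cong (_∸ (s +ℕ a *ℕ s)) r+s≡1+m))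
  too-big : ∀ a → suc r ≤ a → ¬ suc a *ℕ s ≤ suc m
  too-big a ge le = NP.<-irrefl refl (NP.≤-trans (NP.≤-reflexive (cong suc (sym r+s≡1+m)))
                      (NP.≤-trans (NP.≤-reflexive (NP.+-comm (suc r) s)) (NP.≤-trans (NP.+-monoʳ-≤ s (NP.≤-trans ge (NP.m≤m*n a s))) le)))

-- A partition with parts ≤ K + 1 is a copies of K + 1 followed by a partition with parts ≤ K.
ΣPar-by-multiplicity : ∀ K fuel m → m ≤ fuel → ∀ F →
  ΣL (Par m (suc K)) F ≈F Σ< (suc m) (λ a → cond (a *ℕ suc K NP.≤? m) (ΣPar-prefixed F K a (m ∸ a *ℕ suc K)))
ΣPar-by-multiplicity K fuel zero _ F = ≈F.trans (≈F.sym (≈F.+-identityʳ (F [] ++ []))) (≈F.sym (≈F.trans (Σ<-suc 0 _) (≈F.+-cong (cond-yes (0 NP.≤? 0) z≤n _) (Σ<-0 _))))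
ΣPar-by-multiplicity K (suc fuel) (suc m) (s≤s m≤fuel) F with m NP.<? K
... | no m≮K = ≈F.trans (≈F.reflexive (ΣPar-split m K F (s≤s K≤m)))
                 (≈F.trans (≈F.+-cong (≈F.sym (cond-yes (0 NP.≤? suc m) z≤n _))
                                      (≈F.trans (ΣPar-by-multiplicity K fuel (m ∸ K) (NP.≤-trans (NP.m∸n≤m m K) m≤fuel) (F ∘ (suc K ∷_)))
                                                (Σ-multiplicity-shift K m K≤m (ΣPar-prefixed F K))))
                           (≈F.sym (Σ<-suc (suc m) _)))
  where
  K≤m : K ≤ m
  K≤m = NP.≮⇒≥ m≮K
... | yes m<K = ≈F.trans (≈F.reflexive (cong (λ ls → ΣL ls F) (Par-skip m K K≰m)))
                 (≈F.sym (≈F.trans (Σ<-suc (suc m) _)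
                   (≈F.trans (≈F.+-cong (cond-yes (0 NP.≤? suc m) z≤n _) (Σ-vanish (suc m) (λ a _ → cond-no (suc a *ℕ suc K NP.≤? suc m) (K≰m ∘ NP.≤-trans (NP.m≤m+n (suc K) (a *ℕ suc K))) _)))
                             (≈F.+-identityʳ _))))
  where
  K≰m : ¬ suc K ≤ suc m
  K≰m (s≤s K≤m) = NP.<-irrefl refl (NP.<-≤-trans m<K K≤m)

-- Sums over partitions

mult-∷-same : ∀ j l → mult j (j ∷ l) ≡ suc (mult j l)
mult-∷-same j l = cong length (LP.filter-accept (ℕ._≟ j) {x = j} {xs = l} refl)

mult-∷-other : ∀ j x l → ¬ x ≡ j → mult j (x ∷ l) ≡ mult j l
mult-∷-other j x l ne = cong length (LP.filter-reject (ℕ._≟ j) {x = x} {xs = l} ne)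

mult-replicate-same : ∀ k a l → mult k (replicate a k ++ l) ≡ a +ℕ mult k l
mult-replicate-same k zero l = refl
mult-replicate-same k (suc a) l = trans (mult-∷-same k (replicate a k ++ l)) (cong suc (mult-replicate-same k a l))

mult-replicate-other : ∀ j k a l → ¬ j ≡ k → mult j (replicate a k ++ l) ≡ mult j l
mult-replicate-other j k zero l ne = refl
mult-replicate-other j k (suc a) l ne = trans (mult-∷-other j k (replicate a k ++ l) (λ p → ne (sym p))) (mult-replicate-other j k a l ne)

mult-above : ∀ j l → All (_≤ j) l → mult (suc j) l ≡ 0
mult-above j [] _ = refl
mult-above j (x ∷ l) (le ∷ al) = trans (mult-∷-other (suc j) x l (λ p → NP.<-irrefl refl (NP.≤-trans (NP.≤-reflexive (cong suc (sym p))) (s≤s le)))) (mult-above j l al)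

Supp-Σ : ∀ {Q} n f → (∀ i → Supp Q (f i)) → Supp Q (Σ< n f)
Supp-Σ zero f s = Supp-cong (≈F.sym (Σ<-0 f)) Supp-[]
Supp-Σ (suc n) f s = Supp-cong (≈F.sym (Σ<-suc n f)) (Supp-++ (s 0) (Supp-Σ n (f ∘ suc) (s ∘ suc)))

Supp-cond : ∀ {Q A X} (d : Dec A) → Supp Q X → Supp Q (cond d X)
Supp-cond (yes p) s = Supp-cong (≈F.sym (cond-yes (yes p) p _)) s
Supp-cond (no ¬p) s = Supp-cong (≈F.sym (cond-no (no ¬p) ¬p _)) Supp-[]

Val-subst : ∀ {u v X} → u ≡ v → Val u X → Val v X
Val-subst refl s = s

Hom0-Π : ∀ n f → (∀ i → Hom 0 (f i)) → Hom 0 (Π< n f)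
Hom0-Π zero f s = Supp-cong (≈F.sym (Π<-0 f)) Hom-1
Hom0-Π (suc n) f s = Supp-cong (≈F.sym (Π<-suc n f)) (Hom-* (s 0) (Hom0-Π n (f ∘ suc) (s ∘ suc)))

cond-≈[≤] : ∀ N {u} (d : Dec (u ≤ N)) X → Val u X → X ≈[≤ N ] cond d X
cond-≈[≤] N (yes p) X s = ≈F⇒≈[≤] (≈F.sym (cond-yes (yes p) p X))
cond-≈[≤] N (no ¬p) X s = Trunc.≈S-trans N (Val⇒≈0 (Val-weaken (NP.≰⇒> ¬p) s)) (≈F⇒≈[≤] (≈F.sym (cond-no (no ¬p) ¬p X)))

-- W j a is the weight of a parts equal to j (for part sizes 1 … J); a partition weighs the product of these.
module PartitionSums (W : ℕ → ℕ → Poly) (J : ℕ) (W-zero : ∀ j → W j 0 ≈F 1P) (W-Val : ∀ j a → Val (a *ℕ suc j) (W (suc j) a)) where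

  weight : List ℕ → Poly
  weight l = Π< J (λ j → W (suc j) (mult (suc j) l))

  Σweight : ℕ → ℕ → Poly
  Σweight m K = ΣL (Par m K) weight

  weight-replicate : ∀ K → suc K ≤ J → ∀ a l → PartsIn K l → weight (replicate a (suc K) ++ l) ≈F (W (suc K) a *P weight l)
  weight-replicate K lt a l il = Π-extract J K lt _ _ (W (suc K) a) others this
    where
    mult-l : mult (suc K) l ≡ 0
    mult-l = mult-above K l (All.map proj₂ il)
    others : ∀ j → j < J → ¬ j ≡ K → W (suc j) (mult (suc j) (replicate a (suc K) ++ l)) ≈F W (suc j) (mult (suc j) l)
    others j _ j≢K = ≈F.reflexive (cong (W (suc j)) (mult-replicate-other (suc j) (suc K) a l (j≢K ∘ NP.suc-injective)))
    this : W (suc K) (mult (suc K) (replicate a (suc K) ++ l)) ≈F W (suc K) a *P W (suc K) (mult (suc K) l)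
    this = ≈F.trans (≈F.reflexive (cong (W (suc K)) (trans (mult-replicate-same (suc K) a l) (trans (cong (a +ℕ_) mult-l) (NP.+-identityʳ a)))))
           (≈F.trans (≈F.sym (≈F.*-identityʳ (W (suc K) a))) (≈F.*-congˡ {W (suc K) a} (≈F.trans (≈F.sym (W-zero (suc K))) (≈F.reflexive (cong (W (suc K)) (sym mult-l))))))

  Σweight-suc : ∀ K → suc K ≤ J → ∀ m →
                Σweight m (suc K) ≈F Σ< (suc m) (λ a → cond (a *ℕ suc K NP.≤? m) (W (suc K) a *P Σweight (m ∸ a *ℕ suc K) K))
  Σweight-suc K lt m = ≈F.trans (ΣPar-by-multiplicity K m m NP.≤-refl weight)
    (Σ-cong (suc m) (λ a → cond-cong (a *ℕ suc K NP.≤? m)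
      (≈F.trans (ΣL-cong (Par-PartsIn (m ∸ a *ℕ suc K) K) (weight-replicate K lt a)) (ΣL-*ˡ (Par (m ∸ a *ℕ suc K) K) (W (suc K) a) weight))))

  Val-Σweight : ∀ K → K ≤ J → ∀ m → Val m (Σweight m K)
  Val-Σweight zero _ zero = Val-0 _
  Val-Σweight zero _ (suc m) = Supp-[]
  Val-Σweight (suc K) lt m = Supp-cong (≈F.sym (Σweight-suc K lt m)) (Supp-Σ (suc m) _ (λ a → Supp-cond (a *ℕ suc K NP.≤? m) (term a)))
    where
    term : ∀ a → Val m (W (suc K) a *P Σweight (m ∸ a *ℕ suc K) K)
    term a = Val-weaken (NP.m≤n+m∸n m (a *ℕ suc K)) (Val-* (W-Val K a) (Val-Σweight K (NP.≤-trans (NP.n≤1+n K) lt) (m ∸ a *ℕ suc K)))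

  Hom-Σweight : ∀ d → (∀ j a → Hom (a *ℕ suc j *ℕ d) (W (suc j) a)) → ∀ K → K ≤ J → ∀ m → Hom (m *ℕ d) (Σweight m K)
  Hom-Σweight d W-Hom zero _ zero = Supp-++ (Hom0-Π J _ (λ j → Supp-cong (≈F.sym (W-zero (suc j))) Hom-1)) Supp-[]
  Hom-Σweight d W-Hom zero _ (suc m) = Supp-[]
  Hom-Σweight d W-Hom (suc K) lt m = Supp-cong (≈F.sym (Σweight-suc K lt m)) (Supp-Σ (suc m) _ term)
    where
    term : ∀ a → Hom (m *ℕ d) (cond (a *ℕ suc K NP.≤? m) (W (suc K) a *P Σweight (m ∸ a *ℕ suc K) K))
    term a with a *ℕ suc K NP.≤? m
    ... | yes le = Supp-cong (≈F.sym (cond-yes (yes le) le _))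
                     (subst (λ e → Hom e (W (suc K) a *P Σweight (m ∸ a *ℕ suc K) K)) (degrees le)
                       (Hom-* (W-Hom K a) (Hom-Σweight d W-Hom K (NP.≤-trans (NP.n≤1+n K) lt) (m ∸ a *ℕ suc K))))
      where
      degrees : a *ℕ suc K ≤ m → a *ℕ suc K *ℕ d +ℕ (m ∸ a *ℕ suc K) *ℕ d ≡ m *ℕ d
      degrees le = trans (sym (NP.*-distribʳ-+ d (a *ℕ suc K) (m ∸ a *ℕ suc K))) (cong (_*ℕ d) (NP.m+[n∸m]≡n le))
    ... | no a≰m = Supp-cong (≈F.sym (cond-no (no a≰m) a≰m _)) Supp-[]

  product-expansion : ∀ N K → K ≤ J → Π< K (λ j → Σ< (suc N) (W (suc j))) ≈[≤ N ] Σ< (suc N) (λ m → Σweight m K)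
  product-expansion N zero _ = ≈F⇒≈[≤] (≈F.sym (≈F.trans (Σ<-suc N (λ m → Σweight m 0))
     (≈F.trans (≈F.+-congˡ {Σweight 0 0} (Σ-vanish N (λ i _ → ≈F.refl)))
     (≈F.trans (≈F.+-identityʳ (Σweight 0 0)) (≈F.trans (≈F.+-identityʳ (weight [])) (≈F.trans (Π-cong< J (λ j _ → W-zero (suc j))) (≈F.trans (Π-1 J) (≈F.sym (Π<-0 _)))))))))
  product-expansion N (suc K) lt = begin
    Π< (suc K) (λ j → Σ< (suc N) (W (suc j)))
      ≈⟨ ≈F⇒≈[≤] (Π-last K (λ j → Σ< (suc N) (W (suc j)))) ⟩
    Π< K (λ j → Σ< (suc N) (W (suc j))) *P Σ< (suc N) (W (suc K))
      ≈⟨ Trunc.*-cong N (product-expansion N K K≤J) (Trunc.≈S-refl N {Σ< (suc N) (W (suc K))}) ⟩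
    Σ< (suc N) (λ b → Σweight b K) *P Σ< (suc N) (W (suc K))
      ≈⟨ ≈F⇒≈[≤] regroup ⟩
    Σ< (suc N) (λ a → Σ< (suc N) (λ b → W (suc K) a *P Σweight b K))
      ≈⟨ ST.Σ-cong N (suc N) (λ a → ST.Σ-cong N (suc N) (λ b → cond-≈[≤] N (a *ℕ suc K +ℕ b NP.≤? N) _ (Val-* (W-Val K a) (Val-Σweight K K≤J b)))) ⟩
    Σ< (suc N) (λ a → Σ< (suc N) (λ b → cond (a *ℕ suc K +ℕ b NP.≤? N) (W (suc K) a *P Σweight b K)))
      ≈⟨ ≈F⇒≈[≤] (≈F.sym (Σ-triangle K N (λ a b → W (suc K) a *P Σweight b K))) ⟩
    Σ< (suc N) (λ m → Σ< (suc m) (λ a → cond (a *ℕ suc K NP.≤? m) (W (suc K) a *P Σweight (m ∸ a *ℕ suc K) K)))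
      ≈⟨ ≈F⇒≈[≤] (Σ-cong (suc N) (λ m → ≈F.sym (Σweight-suc K lt m))) ⟩
    Σ< (suc N) (λ m → Σweight m (suc K)) ∎
    where
    open ≈[≤]-Reasoning N
    K≤J : K ≤ J
    K≤J = NP.≤-trans (NP.n≤1+n K) lt
    regroup : Σ< (suc N) (λ b → Σweight b K) *P Σ< (suc N) (W (suc K)) ≈F Σ< (suc N) (λ a → Σ< (suc N) (λ b → W (suc K) a *P Σweight b K))
    regroup = ≈F.trans (Σ-*-Σ (suc N) (suc N) (λ b → Σweight b K) (W (suc K)))
              (≈F.trans (Σ-swap (suc N) (suc N) (λ b a → Σweight b K *P W (suc K) a))
                        (Σ-cong (suc N) (λ a → Σ-cong (suc N) (λ b → ≈F.*-comm (Σweight b K) (W (suc K) a)))))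

-- The power-sum expansion of h_m

nℚ : ℕ → ℚ
nℚ n = fromℚᵘ (mkℚᵘ (ℤ.+ n) 0)

private
  toℚᵘ-fromℚᵘ : ∀ p → toℚᵘ (fromℚᵘ p) ≃ᵘ p
  toℚᵘ-fromℚᵘ = QP.toℚᵘ-fromℚᵘ

recip-* : ∀ m n → 1 ≤ m → 1 ≤ n → recip (m *ℕ n) ≡ recip m * recip n
recip-* (suc a) (suc b) _ _ = QP.toℚᵘ-injective (UP.≃-trans (toℚᵘ-fromℚᵘ (mkℚᵘ (ℤ.+ 1) (b +ℕ a *ℕ suc b)))
  (UP.≃-sym (UP.≃-trans (QP.toℚᵘ-homo-* (recip (suc a)) (recip (suc b)))
                        (UP.≃-trans (UP.*-cong (toℚᵘ-fromℚᵘ (mkℚᵘ (ℤ.+ 1) a)) (toℚᵘ-fromℚᵘ (mkℚᵘ (ℤ.+ 1) b))) (*≡* refl)))))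

recip-inverse : ∀ n → 1 ≤ n → recip n * nℚ n ≡ 1ℚ
recip-inverse (suc k) _ = QP.toℚᵘ-injective (UP.≃-trans (QP.toℚᵘ-homo-* (recip (suc k)) (nℚ (suc k)))
  (UP.≃-trans (UP.*-cong (toℚᵘ-fromℚᵘ (mkℚᵘ (ℤ.+ 1) k)) (toℚᵘ-fromℚᵘ (mkℚᵘ (ℤ.+ suc k) 0))) (*≡* cross)))
  where
  cross : (ℤ.+ 1 ℤ.* ℤ.+ suc k) ℤ.* ℤ.+ 1 ≡ ℤ.+ 1 ℤ.* ℤ.+ (suc k *ℕ 1)
  cross = trans (ZP.*-identityʳ _) (trans (ZP.*-identityˡ (ℤ.+ suc k)) (sym (trans (ZP.*-identityˡ _) (cong ℤ.+_ (NP.*-identityʳ (suc k))))))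

nℚ-+ : ∀ a b → nℚ (a +ℕ b) ≡ nℚ a + nℚ b
nℚ-+ a b = QP.toℚᵘ-injective (UP.≃-trans (toℚᵘ-fromℚᵘ (mkℚᵘ (ℤ.+ (a +ℕ b)) 0))
  (UP.≃-sym (UP.≃-trans (QP.toℚᵘ-homo-+ (nℚ a) (nℚ b))
                        (UP.≃-trans (UP.+-cong (toℚᵘ-fromℚᵘ (mkℚᵘ (ℤ.+ a) 0)) (toℚᵘ-fromℚᵘ (mkℚᵘ (ℤ.+ b) 0))) (*≡* cross)))))
  where
  cross : (ℤ.+ a ℤ.* ℤ.+ 1 ℤ.+ ℤ.+ b ℤ.* ℤ.+ 1) ℤ.* ℤ.+ 1 ≡ ℤ.+ (a +ℕ b) ℤ.* ℤ.+ (1 *ℕ 1)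
  cross = trans (ZP.*-identityʳ _) (trans (cong₂ ℤ._+_ (ZP.*-identityʳ (ℤ.+ a)) (ZP.*-identityʳ (ℤ.+ b))) (sym (ZP.*-identityʳ (ℤ.+ (a +ℕ b)))))

-- The contribution of a parts equal to j to 1 / z_λ.
zInv : ℕ → ℕ → ℚ
zInv j a = recip (j ^ a *ℕ a !)

expTerm : Poly → ℕ → ℕ → Poly
expTerm C j a = scaleP (zInv j a) (pk j C ^P a)

expWeight : Poly → ℕ → List ℕ → Poly
expWeight C K l = Π< K (λ j → expTerm C (suc j) (mult (suc j) l))

pkProduct : List ℕ → Poly → Poly
pkProduct [] C = 1P
pkProduct (x ∷ l) C = pk x C *P pkProduct l C

plethMono-pMono : ∀ K l C → PartsIn K l → plethMono (pMono l) C ≈F pkProduct l C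
plethMono-pMono K [] C _ = ≈F.refl
plethMono-pMono K (suc x ∷ l) C ((_ , _) ∷ il) = ≈F.trans (plethMono-mulMono (varPow (suc x) 1) (pMono l) C) (≈F.*-cong (plethMono-var x C) (plethMono-pMono K l C il))
plethMono-pMono K (zero ∷ l) C ((() , _) ∷ il)

pkProduct≈Π : ∀ K l C → PartsIn K l → pkProduct l C ≈F Π< K (λ j → pk (suc j) C ^P mult (suc j) l)
pkProduct≈Π K [] C _ = ≈F.sym (≈F.trans (Π-cong< K (λ j _ → ≈F.refl)) (Π-1 K))
pkProduct≈Π K (zero ∷ l) C ((() , _) ∷ _)
pkProduct≈Π K (suc i ∷ l) C ((_ , le) ∷ il) = ≈F.trans (≈F.*-congˡ {pk (suc i) C} (pkProduct≈Π K l C il))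
  (≈F.sym (Π-extract K i le _ _ (pk (suc i) C)
     (λ j _ ne → ≈F.reflexive (cong (pk (suc j) C ^P_) (mult-∷-other (suc j) (suc i) l (λ p → ne (NP.suc-injective (sym p))))))
     (≈F.reflexive (cong (pk (suc i) C ^P_) (mult-∷-same (suc i) l)))))

Πℕ : ℕ → (ℕ → ℕ) → ℕ
Πℕ zero f = 1
Πℕ (suc n) f = f 0 *ℕ Πℕ n (f ∘ suc)

product-applyUpTo : ∀ (f g : ℕ → ℕ) n → product (map f (applyUpTo g n)) ≡ Πℕ n (f ∘ g)
product-applyUpTo f g zero = refl
product-applyUpTo f g (suc n) = cong (f (g 0) *ℕ_) (product-applyUpTo f (g ∘ suc) n)

Πℕ-extend : ∀ A B f → A ≤ B → (∀ j → A ≤ j → j < B → f j ≡ 1) → Πℕ A f ≡ Πℕ B f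
Πℕ-extend zero zero f _ e = refl
Πℕ-extend zero (suc B) f _ e = sym (trans (cong (_*ℕ Πℕ B (f ∘ suc)) (e 0 z≤n (s≤s z≤n)))
  (trans (NP.*-identityˡ _) (sym (Πℕ-extend zero B (f ∘ suc) z≤n (λ j _ lt → e (suc j) z≤n (s≤s lt))))))
Πℕ-extend (suc A) (suc B) f (s≤s le) e = cong (f 0 *ℕ_) (Πℕ-extend A B (f ∘ suc) le (λ j le' lt → e (suc j) (s≤s le') (s≤s lt)))

Πℕ-positive : ∀ n f → (∀ j → 1 ≤ f j) → 1 ≤ Πℕ n f
Πℕ-positive zero f p = s≤s z≤n
Πℕ-positive (suc n) f p = NP.*-mono-≤ (p 0) (Πℕ-positive n (f ∘ suc) (p ∘ suc))

Πℚ : ℕ → (ℕ → ℚ) → ℚ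
Πℚ zero f = 1ℚ
Πℚ (suc n) f = f 0 * Πℚ n (f ∘ suc)

recip-Πℕ : ∀ n f → (∀ j → 1 ≤ f j) → recip (Πℕ n f) ≡ Πℚ n (recip ∘ f)
recip-Πℕ zero f p = refl
recip-Πℕ (suc n) f p = trans (recip-* (f 0) (Πℕ n (f ∘ suc)) (p 0) (Πℕ-positive n (f ∘ suc) (p ∘ suc))) (cong (recip (f 0) *_) (recip-Πℕ n (f ∘ suc) (p ∘ suc)))

zFactor : List ℕ → ℕ → ℕ
zFactor l j = j ^ mult j l *ℕ mult j l !

zFactor-positive : ∀ l j → 1 ≤ zFactor l (suc j)
zFactor-positive l j = NP.*-mono-≤ (NP.m^n>0 (suc j) (mult (suc j) l)) (ℕ.>-nonZero⁻¹ (mult (suc j) l !) {{mult (suc j) l !≢0}})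

mult-zero : ∀ K l → PartsIn K l → mult 0 l ≡ 0
mult-zero K [] _ = refl
mult-zero K (zero ∷ l) ((() , _) ∷ _)
mult-zero K (suc x ∷ l) (_ ∷ il) = trans (mult-∷-other 0 (suc x) l (λ ())) (mult-zero K l il)

All-≤-sum : ∀ l → All (_≤ sum l) l
All-≤-sum [] = []
All-≤-sum (x ∷ l) = NP.m≤m+n x (sum l) ∷ All.map (λ {y} le → NP.≤-trans le (NP.m≤n+m (sum l) x)) (All-≤-sum l)

All-≤-mono : ∀ {a b} l → a ≤ b → All (_≤ a) l → All (_≤ b) l
All-≤-mono l le al = All.map (λ p → NP.≤-trans p le) al

-- zλ runs over 0 ≤ j ≤ |λ|; the j = 0 factor is 1, and factors with j > max λ are 1 as well.
zλ≡Πℕ : ∀ K l → PartsIn K l → zλ l ≡ Πℕ K (zFactor l ∘ suc)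
zλ≡Πℕ K l il = trans (product-applyUpTo (zFactor l) (λ x → x) (suc (sum l)))
  (trans (cong (λ z → (0 ^ z *ℕ z !) *ℕ Πℕ (sum l) (zFactor l ∘ suc)) (mult-zero K l il))
  (trans (NP.+-identityʳ _) same-range))
  where
  trivial-factor : ∀ j → All (_≤ j) l → zFactor l (suc j) ≡ 1
  trivial-factor j al = cong (λ z → suc j ^ z *ℕ z !) (mult-above j l al)
  same-range : Πℕ (sum l) (zFactor l ∘ suc) ≡ Πℕ K (zFactor l ∘ suc)
  same-range with NP.≤-total (sum l) K
  ... | inj₁ le = Πℕ-extend (sum l) K _ le (λ j le' _ → trivial-factor j (All-≤-mono l le' (All-≤-sum l)))
  ... | inj₂ le = sym (Πℕ-extend K (sum l) _ le (λ j le' _ → trivial-factor j (All-≤-mono l le' (All.map proj₂ il))))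

recip-zλ≡Πℚ : ∀ K l → PartsIn K l → recip (zλ l) ≡ Πℚ K (λ j → zInv (suc j) (mult (suc j) l))
recip-zλ≡Πℚ K l il = trans (cong recip (zλ≡Πℕ K l il)) (recip-Πℕ K (zFactor l ∘ suc) (zFactor-positive l))

scaleP-*-*P : ∀ a b X Y → scaleP (a * b) (X *P Y) ≈F (scaleP a X *P scaleP b Y)
scaleP-*-*P a b X Y = viaL _ _ λ g gr → trans (L-scaleP g (a * b) (X *P Y)) (trans (cong ((a * b) *_) (L-* g X Y))
  (sym (trans (L-* g (scaleP a X) (scaleP b Y)) (trans (L-scaleP _ a X) (trans (cong (a *_) (L-ext X (λ x → L-scaleP _ b Y))) (trans (cong (a *_) (L-scaleFun b _ X)) (sym (QP.*-assoc a b _))))))))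

scaleP-Πℚ : ∀ K (q : ℕ → ℚ) (y : ℕ → Poly) → scaleP (Πℚ K q) (Π< K y) ≈F Π< K (λ j → scaleP (q j) (y j))
scaleP-Πℚ zero q y = ≈F.trans (scaleP-cong 1ℚ (Π<-0 y)) (≈F.trans (viaL _ _ λ g gr → refl) (≈F.sym (Π<-0 _)))
scaleP-Πℚ (suc K) q y = ≈F.trans (scaleP-cong (Πℚ (suc K) q) (Π<-suc K y)) (≈F.trans (scaleP-*-*P (q 0) (Πℚ K (q ∘ suc)) (y 0) (Π< K (y ∘ suc)))
  (≈F.trans (≈F.*-congˡ {scaleP (q 0) (y 0)} (scaleP-Πℚ K (q ∘ suc) (y ∘ suc))) (≈F.sym (Π<-suc K _))))

pleth-hTerm : ∀ C K l → PartsIn K l → pleth ((recip (zλ l) , pMono l) ∷ []) C ≈F expWeight C K l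
pleth-hTerm C K l il = ≈F.trans (pleth-single (recip (zλ l)) (pMono l) C)
  (≈F.trans (scaleP-cong (recip (zλ l)) (≈F.trans (plethMono-pMono K l C il) (pkProduct≈Π K l C il)))
  (≈F.trans (≈F.reflexive (cong (λ z → scaleP z (Π< K (λ j → pk (suc j) C ^P mult (suc j) l))) (recip-zλ≡Πℚ K l il)))
  (scaleP-Πℚ K (λ j → zInv (suc j) (mult (suc j) l)) (λ j → pk (suc j) C ^P mult (suc j) l))))

-- The exponential law for Ω, modulo t^{N+1}

n!≡nCk*k!*[n∸k]! : ∀ c a → a ≤ c → c ! ≡ (c choose a) *ℕ (a ! *ℕ (c ∸ a) !)
n!≡nCk*k!*[n∸k]! c a le = sym (trans (cong (_*ℕ (a ! *ℕ (c ∸ a) !)) (NCS.nCk≡n!/k![n-k]! le)) (DM.m/n*n≡m {{a !* (c ∸ a) !≢0}} (NC.k![n∸k]!∣n! le)))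

1≤! : ∀ n → 1 ≤ n !
1≤! n = ℕ.>-nonZero⁻¹ (n !) {{n !≢0}}

1≤choose : ∀ c a → a ≤ c → 1 ≤ c choose a
1≤choose c a le with c choose a | n!≡nCk*k!*[n∸k]! c a le
... | zero | e = ⊥-elim (NP.<-irrefl refl (NP.≤-trans (1≤! c) (NP.≤-reflexive e)))
... | suc _ | e = s≤s z≤n

zInv-binomial : ∀ j c a → a ≤ c → zInv (suc j) c * nℚ (c choose a) ≡ zInv (suc j) a * zInv (suc j) (c ∸ a)
zInv-binomial j c a a≤c = begin
  recip (suc j ^ c *ℕ c !) * nℚ k    ≡⟨ cong (λ z → recip z * nℚ k) z-split ⟩
  recip (k *ℕ (X *ℕ Y)) * nℚ k       ≡⟨ cong (_* nℚ k) (trans (recip-* k (X *ℕ Y) 1≤k (NP.*-mono-≤ 1≤X 1≤Y)) (cong (recip k *_) (recip-* X Y 1≤X 1≤Y))) ⟩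
  recip k * (recip X * recip Y) * nℚ k ≡⟨ cancel (recip k) (nℚ k) (recip X) (recip Y) (recip-inverse k 1≤k) ⟩
  recip X * recip Y                  ∎
  where
  open ≡-Reasoning
  k = c choose a
  X = suc j ^ a *ℕ a !
  Y = suc j ^ (c ∸ a) *ℕ (c ∸ a) !
  1≤k : 1 ≤ k
  1≤k = 1≤choose c a a≤c
  1≤X : 1 ≤ X
  1≤X = NP.*-mono-≤ (NP.m^n>0 (suc j) a) (1≤! a)
  1≤Y : 1 ≤ Y
  1≤Y = NP.*-mono-≤ (NP.m^n>0 (suc j) (c ∸ a)) (1≤! (c ∸ a))
  rearrange : ∀ p q k u v → (p *ℕ q) *ℕ (k *ℕ (u *ℕ v)) ≡ k *ℕ ((p *ℕ u) *ℕ (q *ℕ v))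
  rearrange = solveℕ-∀
  z-split : suc j ^ c *ℕ c ! ≡ k *ℕ (X *ℕ Y)
  z-split = trans (cong₂ _*ℕ_ (trans (cong (suc j ^_) (sym (NP.m+[n∸m]≡n a≤c))) (NP.^-distribˡ-+-* (suc j) a (c ∸ a))) (n!≡nCk*k!*[n∸k]! c a a≤c))
                  (rearrange (suc j ^ a) (suc j ^ (c ∸ a)) k (a !) ((c ∸ a) !))
  cancel : ∀ rk nk rx ry → rk * nk ≡ 1ℚ → rk * (rx * ry) * nk ≡ rx * ry
  cancel rk nk rx ry e = trans (regroup rk nk rx ry) (trans (cong (_* (rx * ry)) e) (QP.*-identityˡ _))
    where
    regroup : ∀ rk nk rx ry → rk * (rx * ry) * nk ≡ (rk * nk) * (rx * ry)
    regroup = solve 4 (λ rk nk rx ry → rk :* (rx :* ry) :* nk := (rk :* nk) :* (rx :* ry)) refl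

module Binomial = BinomialTheorem ≈F.commutativeSemiring

open import Algebra.Properties.Semiring.Exp ≈F.semiring using () renaming (_^_ to powB)
open import Algebra.Properties.Semiring.Mult ≈F.semiring using () renaming (_×_ to timesB)
open import Algebra.Properties.Semiring.Sum ≈F.semiring using () renaming (sum to sumB)

powB≈^P : ∀ x n → powB x n ≈F (x ^P n)
powB≈^P x zero = ≈F.refl
powB≈^P x (suc n) = ≈F.*-congˡ {x} (powB≈^P x n)

scaleP-0 : ∀ X → scaleP 0ℚ X ≈F []
scaleP-0 X = viaL _ _ λ g gr → trans (L-scaleP g 0ℚ X) (QP.*-zeroˡ (L g X))

timesB≈scaleP : ∀ n X → timesB n X ≈F scaleP (nℚ n) X
timesB≈scaleP zero X = ≈F.sym (scaleP-0 X)
timesB≈scaleP (suc n) X = ≈F.trans (≈F.+-congˡ {X} (timesB≈scaleP n X)) (viaL _ _ λ g gr → trans (L-++ g X (scaleP (nℚ n) X)) (trans (cong (L g X +_) (L-scaleP g (nℚ n) X))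
   (sym (trans (L-scaleP g (nℚ (suc n)) X) (trans (cong (_* L g X) (nℚ-+ 1 n)) (rearrange (nℚ n) (L g X)))))))
  where
  rearrange : ∀ a x → (1ℚ + a) * x ≡ x + a * x
  rearrange = solve 2 (λ a x → ((con 1ℚ :+ a) :* x) := (x :+ a :* x)) refl

sumB≈Σ< : ∀ n (f : ℕ → Poly) → sumB {n} (λ i → f (toℕ i)) ≈F Σ< n f
sumB≈Σ< zero f = ≈F.sym (Σ<-0 f)
sumB≈Σ< (suc n) f = ≈F.trans (≈F.+-congˡ {f 0} (sumB≈Σ< n (f ∘ suc))) (≈F.sym (Σ<-suc n f))

binomial-theorem : ∀ x y c → ((x ++ y) ^P c) ≈F Σ< (suc c) (λ a → scaleP (nℚ (c choose a)) ((x ^P a) *P (y ^P (c ∸ a))))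
binomial-theorem x y c = ≈F.trans (≈F.sym (powB≈^P (x ++ y) c)) (≈F.trans (Binomial.theorem c x y)
  (≈F.trans (sumB≈Σ< (suc c) (λ a → timesB (c choose a) (powB x a *P powB y (c ∸ a))))
  (Σ-cong (suc c) (λ a → ≈F.trans (timesB≈scaleP (c choose a) _) (scaleP-cong (nℚ (c choose a)) (≈F.*-cong (powB≈^P x a) (powB≈^P y (c ∸ a))))))))

scaleP-Σ< : ∀ c n f → scaleP c (Σ< n f) ≈F Σ< n (λ i → scaleP c (f i))
scaleP-Σ< c zero f = ≈F.trans (scaleP-cong c (Σ<-0 f)) (≈F.sym (Σ<-0 _))
scaleP-Σ< c (suc n) f = ≈F.trans (scaleP-cong c (Σ<-suc n f)) (≈F.trans (≈F.reflexive (scaleP-++ c (f 0) (Σ< n (f ∘ suc))))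
  (≈F.trans (≈F.+-congˡ {scaleP c (f 0)} (scaleP-Σ< c n (f ∘ suc))) (≈F.sym (Σ<-suc n _))))

expTerm-binomial : ∀ j x y c → scaleP (zInv (suc j) c) ((x ++ y) ^P c) ≈F Σ< (suc c) (λ a → scaleP (zInv (suc j) a) (x ^P a) *P scaleP (zInv (suc j) (c ∸ a)) (y ^P (c ∸ a)))
expTerm-binomial j x y c = ≈F.trans (scaleP-cong (zInv (suc j) c) (binomial-theorem x y c)) (≈F.trans (scaleP-Σ< (zInv (suc j) c) (suc c) _)
  (Σ-cong< (suc c) (λ a lt → ≈F.trans (scaleP-scaleP (zInv (suc j) c) (nℚ (c choose a)) _)
     (≈F.trans (≈F.reflexive (cong (λ z → scaleP z ((x ^P a) *P (y ^P (c ∸ a)))) (zInv-binomial j c a (NP.≤-pred lt))))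
     (scaleP-*-*P (zInv (suc j) a) (zInv (suc j) (c ∸ a)) (x ^P a) (y ^P (c ∸ a)))))))

Val-expTerm : ∀ {Cp} → Val 1 Cp → ∀ j a → Val (a *ℕ suc j) (expTerm Cp (suc j) a)
Val-expTerm v1 j a = Val-subst (cong (a *ℕ_) (NP.*-identityʳ (suc j))) (Supp-scale (zInv (suc j) a) (Val-^ a (Val-pk j v1)))

expTerm-zero : ∀ Cp j → expTerm Cp j 0 ≈F 1P
expTerm-zero Cp j = viaL _ _ λ g gr → refl

-- exp (p_j[C] / j), cut off after the term p_j[C]^N.
exp≤ : ℕ → Poly → ℕ → Poly
exp≤ N C j = Σ< (suc N) (expTerm C j)

exp≤-+ : ∀ N j C D → Val 1 C → Val 1 D → exp≤ N (C ++ D) (suc j) ≈[≤ N ] exp≤ N C (suc j) *P exp≤ N D (suc j)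
exp≤-+ N j C D vC vD = begin
  Σ< (suc N) (expTerm (C ++ D) (suc j))
    ≈⟨ ≈F⇒≈[≤] (Σ-cong (suc N) binomial) ⟩
  Σ< (suc N) (λ c → Σ< (suc c) (λ a → G a (c ∸ a)))
    ≈⟨ ≈F⇒≈[≤] (Σ-cong< (suc N) (λ c _ → Σ-cong< (suc c) (λ a lt → ≈F.sym (guard c a (NP.≤-pred lt))))) ⟩
  Σ< (suc N) (λ c → Σ< (suc c) (λ a → cond (a *ℕ 1 NP.≤? c) (G a (c ∸ a *ℕ 1))))
    ≈⟨ ≈F⇒≈[≤] (Σ-triangle 0 N G) ⟩
  Σ< (suc N) (λ a → Σ< (suc N) (λ b → cond (a *ℕ 1 +ℕ b NP.≤? N) (G a b)))
    ≈⟨ ST.Σ-cong N (suc N) (λ a → ST.Σ-cong N (suc N) (λ b → Trunc.≈S-sym N (cond-≈[≤] N (a *ℕ 1 +ℕ b NP.≤? N) (G a b) (Val-G a b)))) ⟩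
  Σ< (suc N) (λ a → Σ< (suc N) (λ b → G a b))
    ≈⟨ ≈F⇒≈[≤] (≈F.sym (Σ-*-Σ (suc N) (suc N) (expTerm C (suc j)) (expTerm D (suc j)))) ⟩
  Σ< (suc N) (expTerm C (suc j)) *P Σ< (suc N) (expTerm D (suc j)) ∎
  where
  open ≈[≤]-Reasoning N
  G : ℕ → ℕ → Poly
  G a b = expTerm C (suc j) a *P expTerm D (suc j) b
  binomial : ∀ c → expTerm (C ++ D) (suc j) c ≈F Σ< (suc c) (λ a → G a (c ∸ a))
  binomial c = ≈F.trans (≈F.reflexive (cong (λ P → scaleP (zInv (suc j) c) (P ^P c)) (pk-+P (suc j) C D)))
                        (expTerm-binomial j (pk (suc j) C) (pk (suc j) D) c)
  guard : ∀ c a → a ≤ c → cond (a *ℕ 1 NP.≤? c) (G a (c ∸ a *ℕ 1)) ≈F G a (c ∸ a)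
  guard c a a≤c = ≈F.trans (cond-yes (a *ℕ 1 NP.≤? c) (subst (_≤ c) (sym (NP.*-identityʳ a)) a≤c) _)
                           (≈F.reflexive (cong (G a) (cong (c ∸_) (NP.*-identityʳ a))))
  Val-G : ∀ a b → Val (a *ℕ 1 +ℕ b) (G a b)
  Val-G a b = Val-weaken (NP.+-mono-≤ (NP.*-monoʳ-≤ a (s≤s z≤n)) (NP.≤-trans (NP.≤-reflexive (sym (NP.*-identityʳ b))) (NP.*-monoʳ-≤ b (s≤s z≤n))))
                         (Val-* (Val-expTerm vC j a) (Val-expTerm vD j b))

pleth-map-singletons : ∀ (f : List ℕ → ℚ × Mono) ls C → pleth (map f ls) C ≈F ΣL ls (λ l → pleth (f l ∷ []) C)
pleth-map-singletons f [] C = ≈F.refl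
pleth-map-singletons f (l ∷ ls) C = ≈F.+-cong (≈F.sym (≈F.+-identityʳ (scaleP (proj₁ (f l)) (plethMono (proj₂ (f l)) C)))) (pleth-map-singletons f ls C)

pleth-h≈Σweight : ∀ C N m → m ≤ N → pleth (h m) C ≈F ΣL (Par m N) (expWeight C N)
pleth-h≈Σweight C N m le = ≈F.trans (pleth-map-singletons (λ l → (recip (zλ l) , pMono l)) (Par m m) C)
  (≈F.trans (ΣL-cong (Par-PartsIn m m) (λ l il → pleth-hTerm C N l (PartsIn-mono le il)))
  (≈F.reflexive (cong (λ ls → ΣL ls (expWeight C N)) (sym (Par-≥ m N le)))))

Ω≤ : ℕ → Poly → Poly
Ω≤ N C = Σ< (suc N) (λ m → pleth (h m) C)

Ω≤-cong : ∀ N {X Y} → X ≈F Y → Ω≤ N X ≈F Ω≤ N Y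
Ω≤-cong N e = Σ-cong (suc N) (λ m → pleth-congʳ (h m) e)

Ω≤≈Πexp≤ : ∀ N C → Val 1 C → Ω≤ N C ≈[≤ N ] Π< N (λ j → exp≤ N C (suc j))
Ω≤≈Πexp≤ N C v = Trunc.≈S-trans N (≈F⇒≈[≤] (Σ-cong< (suc N) (λ m lt → pleth-h≈Σweight C N m (NP.≤-pred lt))))
                                  (Trunc.≈S-sym N (PS.product-expansion N N NP.≤-refl))
  where
  module PS = PartitionSums (expTerm C) N (expTerm-zero C) (Val-expTerm v)

Ω≤-+ : ∀ N C D → Val 1 C → Val 1 D → Ω≤ N (C ++ D) ≈[≤ N ] Ω≤ N C *P Ω≤ N D
Ω≤-+ N C D vC vD = begin
  Ω≤ N (C ++ D)
    ≈⟨ Ω≤≈Πexp≤ N (C ++ D) (Supp-++ vC vD) ⟩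
  Π< N (λ j → exp≤ N (C ++ D) (suc j))
    ≈⟨ ST.Π-cong< N N (λ j _ → exp≤-+ N j C D vC vD) ⟩
  Π< N (λ j → exp≤ N C (suc j) *P exp≤ N D (suc j))
    ≈⟨ ≈F⇒≈[≤] (Π-* N (λ j → exp≤ N C (suc j)) (λ j → exp≤ N D (suc j))) ⟩
  Π< N (λ j → exp≤ N C (suc j)) *P Π< N (λ j → exp≤ N D (suc j))
    ≈⟨ Trunc.≈S-sym N (Trunc.*-cong N (Ω≤≈Πexp≤ N C vC) (Ω≤≈Πexp≤ N D vD)) ⟩
  Ω≤ N C *P Ω≤ N D ∎
  where open ≈[≤]-Reasoning N

Ω≤-[] : ∀ N → Ω≤ N [] ≈[≤ N ] 1P
Ω≤-[] N = Trunc.≈S-trans N (Ω≤≈Πexp≤ N [] Supp-[]) (≈F⇒≈[≤] (≈F.trans (Π-cong< N (λ j _ → exp≤-[] (suc j))) (Π-1 N)))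
  where
  exp≤-[] : ∀ j → exp≤ N [] j ≈F 1P
  exp≤-[] j = ≈F.trans (Σ<-suc N (expTerm [] j))
                (≈F.trans (≈F.+-congˡ {expTerm [] j 0} (Σ-vanish N (λ _ _ → ≈F.refl))) (≈F.trans (≈F.+-identityʳ (expTerm [] j 0)) (expTerm-zero [] j)))

Ω≤-Σ : ∀ N k (Cs : ℕ → Poly) → (∀ j → Val 1 (Cs j)) → Ω≤ N (Σ< k Cs) ≈[≤ N ] Π< k (λ j → Ω≤ N (Cs j))
Ω≤-Σ N zero Cs v = Trunc.≈S-trans N (≈F⇒≈[≤] (Ω≤-cong N (Σ<-0 Cs))) (Trunc.≈S-trans N (Ω≤-[] N) (≈F⇒≈[≤] (≈F.sym (Π<-0 _))))
Ω≤-Σ N (suc k) Cs v = begin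
  Ω≤ N (Σ< (suc k) Cs)
    ≈⟨ ≈F⇒≈[≤] (Ω≤-cong N (Σ<-suc k Cs)) ⟩
  Ω≤ N (Cs 0 ++ Σ< k (Cs ∘ suc))
    ≈⟨ Ω≤-+ N (Cs 0) (Σ< k (Cs ∘ suc)) (v 0) (Supp-Σ k (Cs ∘ suc) (v ∘ suc)) ⟩
  Ω≤ N (Cs 0) *P Ω≤ N (Σ< k (Cs ∘ suc))
    ≈⟨ Trunc.*-cong N (Trunc.≈S-refl N {Ω≤ N (Cs 0)}) (Ω≤-Σ N k (Cs ∘ suc) (v ∘ suc)) ⟩
  Ω≤ N (Cs 0) *P Π< k (λ j → Ω≤ N (Cs (suc j)))
    ≈⟨ ≈F⇒≈[≤] (≈F.sym (Π<-suc k (λ j → Ω≤ N (Cs j)))) ⟩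
  Π< (suc k) (λ j → Ω≤ N (Cs j)) ∎
  where open ≈[≤]-Reasoning N

Hom-expTerm : ∀ {C} d → Hom d C → ∀ j a → Hom (a *ℕ suc j *ℕ d) (expTerm C (suc j) a)
Hom-expTerm {C} d s j a = subst (λ e → Hom e (expTerm C (suc j) a)) (sym (NP.*-assoc a (suc j) d)) (Supp-scale (zInv (suc j) a) (Hom-^ a (Hom-pk j s)))

Hom-pleth-h : ∀ C d → Hom (suc d) C → ∀ m → Hom (m *ℕ suc d) (pleth (h m) C)
Hom-pleth-h C d s m = Supp-cong (≈F.sym (pleth-h≈Σweight C m m NP.≤-refl)) (PS.Hom-Σweight (suc d) (Hom-expTerm (suc d) s) m NP.≤-refl m)
  where
  module PS = PartitionSums (expTerm C) m (expTerm-zero C) (Val-expTerm (Val-weaken (s≤s z≤n) (Hom⇒Val s)))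

Hom-singleton : ∀ c a → Hom (tExp a) ((c , a) ∷ [])
Hom-singleton c a = Supp-cong (viaL _ _ λ g gr → cong (λ z → z * g a + 0ℚ) (QP.*-identityʳ c)) (Supp-scale c (Hom-monoP a))

tExp-pMono : ∀ K l → PartsIn K l → tExp (pMono l) ≡ 0
tExp-pMono K [] _ = refl
tExp-pMono K (zero ∷ l) ((() , _) ∷ _)
tExp-pMono K (suc x ∷ l) (_ ∷ il) = trans (tExp-mulMono (varPow (suc x) 1) (pMono l)) (tExp-pMono K l il)

map≡ΣL : ∀ (f : List ℕ → ℚ × Mono) ls → map f ls ≡ ΣL ls (λ l → f l ∷ [])
map≡ΣL f [] = refl
map≡ΣL f (l ∷ ls) = cong (f l ∷_) (map≡ΣL f ls)

Hom0-h : ∀ i → Hom 0 (h i)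
Hom0-h i = subst (Hom 0) (sym (map≡ΣL (λ l → (recip (zλ l) , pMono l)) (Par i i)))
  (Supp-ΣL (Par-PartsIn i i) (λ l il → subst (λ e → Hom e ((recip (zλ l) , pMono l) ∷ [])) (tExp-pMono i l il) (Hom-singleton (recip (zλ l)) (pMono l))))

atT1-ΣL : ∀ ls F → atT1 (ΣL ls F) ≡ ΣL ls (atT1 ∘ F)
atT1-ΣL [] F = refl
atT1-ΣL (x ∷ ls) F = trans (atT1-++ (F x) (ΣL ls F)) (cong (atT1 (F x) ++_) (atT1-ΣL ls F))

atT1-Π : ∀ k f → atT1 (Π< k f) ≈F Π< k (atT1 ∘ f)
atT1-Π zero f = ≈F.trans (atT1-cong (Π<-0 f)) (≈F.sym (Π<-0 _))
atT1-Π (suc k) f = ≈F.trans (atT1-cong (Π<-suc k f)) (≈F.trans (atT1-*P (f 0) (Π< k (f ∘ suc))) (≈F.trans (≈F.*-congˡ {atT1 (f 0)} (atT1-Π k (f ∘ suc))) (≈F.sym (Π<-suc k _))))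

tCoeff-Σ : ∀ n k f → tCoeff n (Σ< k f) ≈F Σ< k (λ m → tCoeff n (f m))
tCoeff-Σ n zero f = ≈F.trans (tCoeff-cong n (≈F⇒≈[≤] (Σ<-0 f))) (≈F.sym (Σ<-0 _))
tCoeff-Σ n (suc k) f = ≈F.trans (tCoeff-cong n (≈F⇒≈[≤] (Σ<-suc k f))) (≈F.trans (tCoeff-++ n (f 0) (Σ< k (f ∘ suc)))
  (≈F.trans (≈F.+-congˡ {tCoeff n (f 0)} (tCoeff-Σ n k (f ∘ suc))) (≈F.sym (Σ<-suc k _))))

tCoeff-Σ-Hom : ∀ n (f : ℕ → Poly) → (∀ m → Hom m (f m)) → tCoeff n (Σ< (suc n) f) ≈F atT1 (f n)
tCoeff-Σ-Hom n f f-Hom = ≈F.trans (tCoeff-Σ n (suc n) f)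
  (≈F.trans (Σ-last n (λ m → tCoeff n (f m)))
  (≈F.trans (≈F.+-congʳ (Σ-vanish n (λ m m<n → tCoeff-Hom-other (f-Hom m) (λ m≡n → NP.<-irrefl m≡n m<n))))
  (≈F.trans (≈F.+-identityˡ _) (tCoeff-Hom-same (f-Hom n)))))

-- Bell symmetric functions

htX : ℕ → Poly
htX j = pleth (h j) tX

Hom-htX : ∀ j → Hom (suc j) (htX (suc j))
Hom-htX j = subst (λ e → Hom e (htX (suc j))) (NP.*-identityʳ (suc j)) (Hom-pleth-h tX 0 (Hom-monoP (mulMono (varPow 0 1) (varPow 1 1))) (suc j))

atT1-htX : ∀ j → atT1 (htX j) ≈F h j
atT1-htX j = ≈F.trans (atT1-pleth (h j) tX) (≈F.trans (pleth-congˡ (pP 1) (atT1-Hom0 (Hom0-h j))) (pleth-p₁ (h j)))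

bellFactor : ℕ → ℕ → Poly
bellFactor j a = pleth (h a) (htX j)

Hom-bellFactor : ∀ j a → Hom (a *ℕ suc j) (bellFactor (suc j) a)
Hom-bellFactor j a = Hom-pleth-h (htX (suc j)) j (Hom-htX j) a

atT1-bellFactor : ∀ j a → atT1 (bellFactor j a) ≈F pleth (h a) (h j)
atT1-bellFactor j a = ≈F.trans (atT1-pleth (h a) (htX j))
  (≈F.trans (pleth-congˡ (atT1 (htX j)) (atT1-Hom0 (Hom0-h a))) (pleth-congʳ (h a) (atT1-htX j)))

module BellSums (n : ℕ) = PartitionSums bellFactor n (λ _ → ≈F.refl) (λ j a → Hom⇒Val (Hom-bellFactor j a))

ΩΩ₀tX≈Σweight : ∀ n → ΩΩ₀tX-trunc n ≈[≤ n ] Σ< (suc n) (λ m → BellSums.Σweight n m n)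
ΩΩ₀tX≈Σweight n = begin
  ΩΩ₀tX-trunc n
    ≈⟨ ≈F⇒≈[≤] (≈F.trans (sumP-applyUpTo (λ m → pleth (h m) (Ω₀tX-trunc n)) (λ x → x) (suc n))
                         (Ω≤-cong n (sumP-applyUpTo (λ j → htX (suc j)) (λ x → x) n))) ⟩
  Ω≤ n (Σ< n (λ j → htX (suc j)))
    ≈⟨ Ω≤-Σ n n (λ j → htX (suc j)) (λ j → Val-weaken (s≤s z≤n) (Hom⇒Val (Hom-htX j))) ⟩
  Π< n (λ j → Σ< (suc n) (bellFactor (suc j)))
    ≈⟨ product-expansion n n NP.≤-refl ⟩
  Σ< (suc n) (λ m → Σweight m n) ∎
  where
  open BellSums n
  open ≈[≤]-Reasoning n

Hom-Σweight-bell : ∀ n m → Hom m (BellSums.Σweight n m n)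
Hom-Σweight-bell n m = subst (λ e → Hom e (Σweight m n)) (NP.*-identityʳ m) (Hom-Σweight 1 Hom-bellFactor′ n NP.≤-refl m)
  where
  open BellSums n
  Hom-bellFactor′ : ∀ j a → Hom (a *ℕ suc j *ℕ 1) (bellFactor (suc j) a)
  Hom-bellFactor′ j a = subst (λ e → Hom e (bellFactor (suc j) a)) (sym (NP.*-identityʳ (a *ℕ suc j))) (Hom-bellFactor j a)

atT1-Σweight : ∀ n → atT1 (BellSums.Σweight n n n) ≈F bellRHS n
atT1-Σweight n = ≈F.trans (≈F.reflexive (atT1-ΣL (Par n n) weight))
  (ΣL-cong (Par-PartsIn n n) (λ l _ → ≈F.trans (atT1-Π n (λ j → bellFactor (suc j) (mult (suc j) l)))
     (≈F.trans (Π-cong< n (λ j _ → atT1-bellFactor (suc j) (mult (suc j) l)))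
       (≈F.sym (prodP-applyUpTo (λ j → pleth (h (mult (suc j) l)) (h (suc j))) (λ x → x) n)))))
  where open BellSums n

mainTheorem7 : (n : ℕ) → B n ≈P bellRHS n
mainTheorem7 n = toCoeff (begin
  tCoeff n (ΩΩ₀tX-trunc n)                ≈⟨ tCoeff-cong n (ΩΩ₀tX≈Σweight n) ⟩
  tCoeff n (Σ< (suc n) (λ m → Σweight m n)) ≈⟨ tCoeff-Σ-Hom n (λ m → Σweight m n) (Hom-Σweight-bell n) ⟩
  atT1 (Σweight n n)                       ≈⟨ atT1-Σweight n ⟩
  bellRHS n                                ∎)
  where
  open BellSums n
  open SetoidReasoning ≈F.setoid
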